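{- Let $p$ be a prime and $n\ge 2$ an integer with $p>n+1$. Let $G$ be the pro-$p$ Iwahori subgroup of $SL_n(\mathbb{Z}_p)$. Then every $g\in G$ has a unique expression of the form $$g=\prod_{\beta\in\Phi^- }x_\beta(u_\beta)\prod_{\delta\in\Pi}h_\delta(1+v_\delta)\prod_{\alpha\in\Phi^+}x_\alpha(w_\alpha),$$ with $u_\beta,v_\delta\in p\mathbb{Z}_p$ and $w_\alpha\in\mathbb{Z}_p$, where the products are taken in the following order: (i) the factors $x_\beta(u_\beta)$, $\beta\in\Phi^-$, in order of increasing height of $\beta$ (roots of equal height in increasing column index, i.e. $(n,1),(n-1,1),(n,2),(n-2,1),\dots$); (ii) the factors $h_\delta(1+v_\delta)$ in the order $\delta=(1,2),(2,3),\dots,(n-1,n)$; (iii) the factors $x_\alpha(w_\alpha)$, $\alpha\in\Phi^+$, ordered so that $(i,j)$ comes before $(k,l)$ if and only if $i>k$, or $i=k$ and $j>l$ (i.e. starting at $(n-1,n)$ and filling rows from the right, going up, ending at $(1,2)$).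
   Context: $G$ is the group of matrices in $SL_n(\mathbb{Z}_p)$ which are upper unipotent modulo $p$. Roots: $\Phi=\{(i,j):1\le i\ne j\le n\}$, $\Phi^+=\{(i,j):i<j\}$, $\Phi^-=\{(i,j):i>j\}$, $\Pi=\{(i,i+1):1\le i\le n-1\}$ (simple roots). The height of $(i,j)$ is $j-i$. $E_{i,j}$ denotes the elementary matrix with $1$ in position $(i,j)$ and $0$ elsewhere. For $\varsigma=(i,j)\in\Phi$ and $t\in\mathbb{Z}_p$, $x_\varsigma(t)=I+tE_{i,j}$. For $\delta=(i,i+1)\in\Pi$ and $\lambda\in\mathbb{Z}_p^\times$, $h_\delta(\lambda)$ is the diagonal matrix with $\lambda$ in position $(i,i)$, $\lambda^{ -1}$ in position $(i+1,i+1)$ and $1$ elsewhere on the diagonal. -}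

module Defs where

open import Data.Nat as ℕ using (ℕ; zero; suc; _<_)
open import Data.Integer as ℤ using (ℤ; +_; 0ℤ; 1ℤ; -_)
open import Data.Integer.Divisibility as ℤD using ()
open import Data.Fin using (Fin; zero; suc; toℕ; punchIn; _≟_)
open import Data.List using (List; []; _∷_; concatMap; reverse; allFin; upTo; foldr; map)
open import Data.Product using (_×_; _,_; proj₁; proj₂)
open import Relation.Binary.PropositionalEquality using (_≡_)
open import Data.Bool using (if_then_else_; _∧_)
open import Relation.Nullary.Decidable using (⌊_⌋)

-- A (raw) element is a sequence x : ℕ → ℤ, where x k is a representative
-- of the residue of the p-adic integer modulo p^k.

Seq : Set
Seq = ℕ → ℤ

IsZp : ℕ → Seq → Set
IsZp p x = ∀ k → (+ (p ℕ.^ k)) ℤD.∣ (x (suc k) ℤ.- x k)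

_≈[_]_ : Seq → ℕ → Seq → Set
x ≈[ p ] y = ∀ k → (+ (p ℕ.^ k)) ℤD.∣ (x k ℤ.- y k)

InpZp : ℕ → Seq → Set
InpZp p x = (+ p) ℤD.∣ x 1

0ₚ 1ₚ : Seq
0ₚ _ = 0ℤ
1ₚ _ = 1ℤ

_+ₚ_ _*ₚ_ : Seq → Seq → Seq
(x +ₚ y) k = x k ℤ.+ y k
(x *ₚ y) k = x k ℤ.* y k

-ₚ_ : Seq → Seq
(-ₚ x) k = - x k

-- inverse of the unit 1 + v (for v ∈ pℤ_p): at level k it is the
-- geometric sum  Σ_{i<k} (-v)^i,  since (1+v) Σ_{i<k} (-v)^i = 1 - (-v)^k.
geom : ℤ → ℕ → ℤ
geom a zero = 0ℤ
geom a (suc k) = 1ℤ ℤ.+ a ℤ.* geom a k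

inv1+ : Seq → Seq
inv1+ v k = geom (- v k) k

Mat : ℕ → Set
Mat n = Fin n → Fin n → Seq

sumₚ : ∀ {m} → (Fin m → Seq) → Seq
sumₚ {zero} f = 0ₚ
sumₚ {suc m} f = f zero +ₚ sumₚ (λ i → f (suc i))

δₚ : ∀ {n} → Fin n → Fin n → Seq
δₚ a b = if ⌊ a ≟ b ⌋ then 1ₚ else 0ₚ

Id : ∀ {n} → Mat n
Id = δₚ

_·_ : ∀ {n} → Mat n → Mat n → Mat n
(M · N) a b = sumₚ (λ c → M a c *ₚ N c b)

_≈M[_]_ : ∀ {n} → Mat n → ℕ → Mat n → Set
M ≈M[ p ] N = ∀ a b → M a b ≈[ p ] N a b

sumℤ : ∀ {m} → (Fin m → ℤ) → ℤ
sumℤ {zero} f = 0ℤ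
sumℤ {suc m} f = f zero ℤ.+ sumℤ (λ i → f (suc i))

detℤ : ∀ {n} → (Fin n → Fin n → ℤ) → ℤ
detℤ {zero} M = 1ℤ
detℤ {suc n} M =
  sumℤ (λ j → ((- 1ℤ) ℤ.^ toℕ j) ℤ.* (M zero j ℤ.* detℤ (λ a b → M (suc a) (punchIn j b))))

det : ∀ {n} → Mat n → Seq
det M k = detℤ (λ a b → M a b k)

E : ∀ {n} → Fin n → Fin n → Mat n
E i j a b = if ⌊ a ≟ i ⌋ ∧ ⌊ b ≟ j ⌋ then 1ₚ else 0ₚ

x : ∀ {n} → Fin n → Fin n → Seq → Mat n
x i j t a b = Id a b +ₚ (t *ₚ E i j a b)

-- h_{(i,j)}(λ) for a simple root (i,j) = (i,i+1): diagonal with λ at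
-- (i,i), λ⁻¹ at (j,j), 1 elsewhere.  Here λ = 1 + v and λ⁻¹ = inv1+ v.
h1+ : ∀ {n} → Fin n → Fin n → Seq → Mat n
h1+ i j v a b =
  if ⌊ a ≟ b ⌋
  then (if ⌊ a ≟ i ⌋ then 1ₚ +ₚ v else if ⌊ a ≟ j ⌋ then inv1+ v else 1ₚ)
  else 0ₚ

-- roots (0-based indices: the paper's (i,j) is (i-1,j-1) here)

Root : ℕ → Set
Root n = Fin n × Fin n

Neg Pos Simple : ∀ {n} → Fin n → Fin n → Set
Neg i j = toℕ j < toℕ i
Pos i j = toℕ i < toℕ j
Simple i j = toℕ j ≡ suc (toℕ i)

-- Φ⁻ in order of increasing height (height -(d+1) for d = n-1,…,0),
-- roots of equal height in increasing column index.
negRoots : (n : ℕ) → List (Root n)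
negRoots n = concatMap (λ d → concatMap (λ j → concatMap (λ i →
    if ⌊ toℕ i ℕ.≟ suc d ℕ.+ toℕ j ⌋ then (i , j) ∷ [] else [])
    (allFin n)) (allFin n)) (reverse (upTo n))

simpleRoots : (n : ℕ) → List (Root n)
simpleRoots n = concatMap (λ i → concatMap (λ j →
    if ⌊ toℕ j ℕ.≟ suc (toℕ i) ⌋ then (i , j) ∷ [] else [])
    (allFin n)) (allFin n)

posRoots : (n : ℕ) → List (Root n)
posRoots n = concatMap (λ i → concatMap (λ j →
    if ⌊ toℕ i ℕ.<? toℕ j ⌋ then (i , j) ∷ [] else [])
    (reverse (allFin n))) (reverse (allFin n))

prodM : ∀ {n} → List (Mat n) → Mat n
prodM = foldr _·_ Id

-- coordinates indexed by pairs (only the relevant roots are used)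
Coords : ℕ → Set
Coords n = Fin n → Fin n → Seq

decomp : ∀ {n} → Coords n → Coords n → Coords n → Mat n
decomp {n} u v w =
  (prodM (map (λ r → x (proj₁ r) (proj₂ r) (u (proj₁ r) (proj₂ r))) (negRoots n))
   · prodM (map (λ r → h1+ (proj₁ r) (proj₂ r) (v (proj₁ r) (proj₂ r))) (simpleRoots n)))
   · prodM (map (λ r → x (proj₁ r) (proj₂ r) (w (proj₁ r) (proj₂ r))) (posRoots n))

InG : ℕ → ∀ {n} → Mat n → Set
InG p g = (∀ a b → IsZp p (g a b))
        × (det g ≈[ p ] 1ₚ)
        × (∀ a b → Neg a b → InpZp p (g a b))
        × (∀ a → InpZp p (g a a +ₚ (-ₚ 1ₚ)))

ValidCoords : ℕ → ∀ {n} → Coords n → Coords n → Coords n → Set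
ValidCoords p u v w = ∀ i j →
    (Neg i j → IsZp p (u i j) × InpZp p (u i j))
  × (Simple i j → IsZp p (v i j) × InpZp p (v i j))
  × (Pos i j → IsZp p (w i j))

SameCoords : ℕ → ∀ {n} → (u v w u' v' w' : Coords n) → Set
SameCoords p u v w u' v' w' = ∀ i j →
    (Neg i j → u i j ≈[ p ] u' i j)
  × (Simple i j → v i j ≈[ p ] v' i j)
  × (Pos i j → w i j ≈[ p ] w' i j)

module Submission where

-- An element of ℤ_p is a compatible sequence of residues modulo pᵏ, so the
-- argument is made at each finite level (congruences modulo m = pᵏ over ℤ)
-- and the levels are then assembled.  At a fixed level:
--   * Gaussian elimination gives a unique factorisation g ≡ ℓ·d·μ with ℓ
--     lower unitriangular and ≡ I mod p, d diagonal ≡ 1 mod p, μ upper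
--     unitriangular; the pivots are units as g is upper unipotent mod p.
--     The same Schur-complement recursion gives det g ≡ ∏ d.
--   * An ordered product of root elements over a list containing each root
--     of a triangular set exactly once is a triangular system in its
--     coordinates, so L(u) ranges bijectively over lower unitriangular
--     matrices and U(w) over upper ones.
--   * H(v) is diagonal with prefix products d₀⋯dᵢ ≡ 1 + v_{(i,i+1)}; as
--     ∏ d ≡ det g ≡ 1 these equations determine v.
-- Uniqueness at each level makes the level-wise solutions compatible, so
-- they are p-adic integers; this gives existence, and level-wise uniqueness
-- gives uniqueness.

open import Defs
open import Data.Nat as ℕ using (ℕ; zero; suc; z≤n; s≤s)
import Data.Nat.Properties as NP
open import Data.Integer as ℤ using (ℤ; +_; 0ℤ; 1ℤ; -_)
import Data.Integer.Properties as ℤP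
import Data.Integer.Divisibility as ℤD
import Data.Integer.Divisibility.Signed as SD
open import Data.Integer.Divisibility.Signed using (divides)
open import Data.Integer.Tactic.RingSolver using (solve-∀)
open import Data.Fin as F using (Fin; zero; suc; toℕ; punchIn; punchOut)
import Data.Fin.Properties as FP
open import Data.Bool using (Bool; true; false; if_then_else_; _∧_)
open import Data.Empty using (⊥-elim)
open import Data.Sum using (_⊎_; inj₁; inj₂)
open import Data.Product using (Σ; Σ-syntax; _,_; _×_; proj₁; proj₂)
open import Data.List using (List; []; _∷_; map; foldr)
open import Data.List.Relation.Unary.All as All using (All; []; _∷_)
open import Function using (_∘_)
open import Relation.Binary.PropositionalEquality
open import Relation.Binary.Definitions using (tri<; tri≈; tri>)
open import Relation.Nullary using (¬_; yes; no; does; Dec)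
open import Relation.Nullary.Decidable using (⌊_⌋; dec-true; dec-false; isYes≗does)

isYes-t : ∀ {A : Set} (d : Dec A) → A → ⌊ d ⌋ ≡ true
isYes-t d a = trans (isYes≗does d) (dec-true d a)

isYes-f : ∀ {A : Set} (d : Dec A) → ¬ A → ⌊ d ⌋ ≡ false
isYes-f d ¬a = trans (isYes≗does d) (dec-false d ¬a)

-- Congruence of integers modulo m, as a record so that m is never lost by
-- unification; it is a congruence for +, *, - and weakens along divisibility.
module Congruence where

  open import Data.Integer using (_+_; _*_; _-_)

  Dv : ℤ → ℤ → Set
  Dv = SD._∣_

  record Cg (m a b : ℤ) : Set where
    constructor cg
    field unCg : Dv m (a - b)
  open Cg public

  private
    l1 : ∀ a → a - a ≡ 0ℤ
    l1 = solve-∀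
    l2 : ∀ a b → b - a ≡ - (a - b)
    l2 = solve-∀
    l3 : ∀ a b c → a - c ≡ (a - b) + (b - c)
    l3 = solve-∀
    l4 : ∀ a b c d → (a + c) - (b + d) ≡ (a - b) + (c - d)
    l4 = solve-∀
    l5 : ∀ a b c d → (a * c) - (b * d) ≡ a * (c - d) + (a - b) * d
    l5 = solve-∀
    l6 : ∀ a b → (- a) - (- b) ≡ - (a - b)
    l6 = solve-∀

  dv0 : ∀ {m} → Dv m 0ℤ
  dv0 = divides 0ℤ refl

  dv-neg : ∀ {m x} → Dv m x → Dv m (- x)
  dv-neg = SD.∣m⇒∣-m

  dv-+ : ∀ {m x y} → Dv m x → Dv m y → Dv m (x + y)
  dv-+ = SD.∣m∣n⇒∣m+n

  dv-*l : ∀ {m} a {x} → Dv m x → Dv m (a * x)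
  dv-*l a = SD.∣n⇒∣m*n a

  dv-*r : ∀ {m x} b → Dv m x → Dv m (x * b)
  dv-*r b = SD.∣m⇒∣m*n b

  dv-≡ : ∀ {m x y} → x ≡ y → Dv m x → Dv m y
  dv-≡ refl d = d

  dv-trans : ∀ {m m' x} → Dv m m' → Dv m' x → Dv m x
  dv-trans = SD.∣-trans

  cg-refl : ∀ {m a} → Cg m a a
  cg-refl {m} {a} = cg (dv-≡ (sym (l1 a)) dv0)

  cg-≡ : ∀ {m a b} → a ≡ b → Cg m a b
  cg-≡ refl = cg-refl

  cg-sym : ∀ {m a b} → Cg m a b → Cg m b a
  cg-sym {m} {a} {b} (cg d) = cg (dv-≡ (sym (l2 a b)) (dv-neg d))

  cg-trans : ∀ {m a b c} → Cg m a b → Cg m b c → Cg m a c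
  cg-trans {m} {a} {b} {c} (cg d) (cg e) = cg (dv-≡ (sym (l3 a b c)) (dv-+ d e))

  cg-+ : ∀ {m a b c d} → Cg m a b → Cg m c d → Cg m (a + c) (b + d)
  cg-+ {m} {a} {b} {c} {d} (cg x) (cg y) = cg (dv-≡ (sym (l4 a b c d)) (dv-+ x y))

  cg-* : ∀ {m a b c d} → Cg m a b → Cg m c d → Cg m (a * c) (b * d)
  cg-* {m} {a} {b} {c} {d} (cg x) (cg y) = cg (dv-≡ (sym (l5 a b c d)) (dv-+ (dv-*l a y) (dv-*r d x)))

  cg-neg : ∀ {m a b} → Cg m a b → Cg m (- a) (- b)
  cg-neg {m} {a} {b} (cg x) = cg (dv-≡ (sym (l6 a b)) (dv-neg x))

  cg-weak : ∀ {m m' a b} → Dv m m' → Cg m' a b → Cg m a b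
  cg-weak d (cg x) = cg (dv-trans d x)

  cg-rewrite : ∀ {m a a' b b'} → a ≡ a' → b ≡ b' → Cg m a' b' → Cg m a b
  cg-rewrite refl refl h = h

  cg-if : ∀ {m} (b : Bool) {x y z w : ℤ} → Cg m x y → Cg m z w → Cg m (if b then x else z) (if b then y else w)
  cg-if true h₁ h₂ = h₁
  cg-if false h₁ h₂ = h₂

  dv→cg0 : ∀ {m x} → Dv m x → Cg m x 0ℤ
  dv→cg0 {m} {x} d = cg (dv-≡ (sym (ℤP.+-identityʳ x)) d)

  cg0→dv : ∀ {m x} → Cg m x 0ℤ → Dv m x
  cg0→dv {m} {x} (cg d) = dv-≡ (ℤP.+-identityʳ x) d

open Congruence

module FiniteSums where

  open import Data.Integer using (_+_; _*_; _-_)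

  sum-ext : ∀ {n} {f g : Fin n → ℤ} → (∀ i → f i ≡ g i) → sumℤ f ≡ sumℤ g
  sum-ext {zero} e = refl
  sum-ext {suc n} e = cong₂ _+_ (e zero) (sum-ext (λ i → e (suc i)))

  sum-cg : ∀ {m n} {f g : Fin n → ℤ} → (∀ i → Cg m (f i) (g i)) → Cg m (sumℤ f) (sumℤ g)
  sum-cg {m} {zero} e = cg-refl
  sum-cg {m} {suc n} e = cg-+ (e zero) (sum-cg (λ i → e (suc i)))

  sum-0 : ∀ {n} → sumℤ {n} (λ _ → 0ℤ) ≡ 0ℤ
  sum-0 {zero} = refl
  sum-0 {suc n} = trans (ℤP.+-identityˡ _) (sum-0 {n})

  sum-+ : ∀ {n} (f g : Fin n → ℤ) → sumℤ (λ i → f i + g i) ≡ sumℤ f + sumℤ g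
  sum-+ {zero} f g = refl
  sum-+ {suc n} f g = trans (cong (λ z → (f zero + g zero) + z) (sum-+ (f ∘ suc) (g ∘ suc))) (lem (f zero) (g zero) _ _)
    where
    lem : ∀ a b c d → a + b + (c + d) ≡ a + c + (b + d)
    lem = solve-∀

  sum-*l : ∀ {n} a (f : Fin n → ℤ) → sumℤ (λ i → a * f i) ≡ a * sumℤ f
  sum-*l {zero} a f = sym (ℤP.*-zeroʳ a)
  sum-*l {suc n} a f = trans (cong (λ z → a * f zero + z) (sum-*l a (f ∘ suc))) (sym (ℤP.*-distribˡ-+ a (f zero) _))

  sum-pick : ∀ {n} (f g : Fin n → ℤ) (c : Fin n) → g c ≡ 0ℤ → (∀ i → i ≢ c → g i ≡ f i) →
             sumℤ f ≡ f c + sumℤ g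
  sum-pick {suc n} f g zero gc e =
    trans (cong (λ z → f zero + z) (trans (sum-ext (λ i → sym (e (suc i) (λ ())))) (sym (ℤP.+-identityˡ _))))
          (cong (λ z → f zero + (z + sumℤ (g ∘ suc))) (sym gc))
  sum-pick {suc n} f g (suc c) gc e =
    trans (cong (λ z → f zero + z) (sum-pick (f ∘ suc) (g ∘ suc) c gc (λ i ne → e (suc i) (λ q → ne (FP.suc-injective q)))))
      (trans (lem (f zero) (f (suc c)) _) (cong (λ z → f (suc c) + (z + sumℤ (g ∘ suc))) (sym (e zero (λ ())))))
    where
    lem : ∀ a b c → a + (b + c) ≡ b + (a + c)
    lem = solve-∀

  sum-pt : ∀ {n} (f : Fin n → ℤ) (c : Fin n) → (∀ i → i ≢ c → f i ≡ 0ℤ) → sumℤ f ≡ f c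
  sum-pt {n} f c e = trans (sum-pick f (λ _ → 0ℤ) c refl (λ i ne → sym (e i ne))) (trans (cong (λ z → f c + z) (sum-0 {n})) (ℤP.+-identityʳ _))

  sum-cg0 : ∀ {m n} (f : Fin n → ℤ) → (∀ i → Cg m (f i) 0ℤ) → Cg m (sumℤ f) 0ℤ
  sum-cg0 {m} {n} f e = cg-trans (sum-cg e) (cg-≡ (sum-0 {n}))

  prodF : ∀ {n} → (Fin n → ℤ) → ℤ
  prodF {zero} f = 1ℤ
  prodF {suc n} f = f zero * prodF (f ∘ suc)

  prod-ext : ∀ {n} {f g : Fin n → ℤ} → (∀ i → f i ≡ g i) → prodF f ≡ prodF g
  prod-ext {zero} e = refl
  prod-ext {suc n} e = cong₂ _*_ (e zero) (prod-ext (λ i → e (suc i)))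

  prod-cg : ∀ {m n} {f g : Fin n → ℤ} → (∀ i → Cg m (f i) (g i)) → Cg m (prodF f) (prodF g)
  prod-cg {m} {zero} e = cg-refl
  prod-cg {m} {suc n} e = cg-* (e zero) (prod-cg (λ i → e (suc i)))

  prod-1 : ∀ {n} → prodF {n} (λ _ → 1ℤ) ≡ 1ℤ
  prod-1 {zero} = refl
  prod-1 {suc n} = trans (ℤP.*-identityˡ _) (prod-1 {n})

  prod-* : ∀ {n} (f g : Fin n → ℤ) → prodF (λ i → f i * g i) ≡ prodF f * prodF g
  prod-* {zero} f g = refl
  prod-* {suc n} f g = trans (cong ((f zero * g zero) *_) (prod-* (f ∘ suc) (g ∘ suc))) (lem (f zero) (g zero) _ _)
    where
    lem : ∀ a b c d → a * b * (c * d) ≡ a * c * (b * d)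
    lem = solve-∀

  prod-pick : ∀ {n} (f g : Fin n → ℤ) (c : Fin n) → g c ≡ 1ℤ → (∀ i → i ≢ c → g i ≡ f i) →
             prodF f ≡ f c * prodF g
  prod-pick {suc n} f g zero gc e =
    trans (cong (f zero *_) (trans (prod-ext (λ i → sym (e (suc i) (λ ())))) (sym (ℤP.*-identityˡ _))))
     (cong (λ z → f zero * (z * prodF (g ∘ suc))) (sym gc))
  prod-pick {suc n} f g (suc c) gc e =
    trans (cong (f zero *_) (prod-pick (f ∘ suc) (g ∘ suc) c gc (λ i ne → e (suc i) (λ q → ne (FP.suc-injective q)))))
      (trans (lem (f zero) (f (suc c)) _) (cong (λ z → f (suc c) * (z * prodF (g ∘ suc))) (sym (e zero (λ ())))))
    where
    lem : ∀ a b c → a * (b * c) ≡ b * (a * c)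
    lem = solve-∀

  prod-cg1 : ∀ {m n} (f : Fin n → ℤ) → (∀ i → Cg m (f i) 1ℤ) → Cg m (prodF f) 1ℤ
  prod-cg1 {m} {n} f e = cg-trans (prod-cg e) (cg-≡ (prod-1 {n}))

  prod-two : ∀ {n} (f : Fin n → ℤ) (q r : Fin n) → q ≢ r → (∀ c → c ≢ q → c ≢ r → f c ≡ 1ℤ) → prodF f ≡ f q * f r
  prod-two {n} f q r qr e =
    trans (prod-pick f g q gq gne)
          (cong (f q *_) (trans (prod-pick g (λ _ → 1ℤ) r refl (λ i ne → sym (g1 i ne)))
                                (trans (cong₂ _*_ (gne r (λ z → qr (sym z))) (prod-1 {n})) (ℤP.*-identityʳ _))))
    where
    g : Fin n → ℤ
    g j = if ⌊ j F.≟ q ⌋ then 1ℤ else f j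
    gq : g q ≡ 1ℤ
    gq rewrite isYes-t (q F.≟ q) refl = refl
    gne : ∀ i → i ≢ q → g i ≡ f i
    gne i ne rewrite isYes-f (i F.≟ q) ne = refl
    g1 : ∀ i → i ≢ r → g i ≡ 1ℤ
    g1 i ne with i F.≟ q
    ... | yes _ = refl
    ... | no ne' = e i ne' ne

open FiniteSums

-- They are needed only for the
-- Schur-complement identity  det g = g₀₀ · det(Schur complement)  used in the
-- LDU step to show det g ≡ ∏ d.
module Determinant where

  open import Data.Integer using (_+_; _*_; _-_)

  MZ : ℕ → Set
  MZ n = Fin n → Fin n → ℤ

  minor : ∀ {n} → Fin (suc n) → MZ (suc n) → MZ n
  minor j M a b = M (suc a) (punchIn j b)

  sg : ∀ {n} → Fin n → ℤ
  sg j = (- 1ℤ) ℤ.^ toℕ j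

  det-ext : ∀ {n} {M N : MZ n} → (∀ a b → M a b ≡ N a b) → detℤ M ≡ detℤ N
  det-ext {zero} e = refl
  det-ext {suc n} e = sum-ext (λ j → cong (sg j *_) (cong₂ _*_ (e zero j) (det-ext (λ a b → e (suc a) (punchIn j b)))))

  rep : ∀ {n} → MZ n → Fin n → (Fin n → ℤ) → MZ n
  rep M q c a b = if does (b F.≟ q) then c a else M a b

  rep-eq : ∀ {n} (M : MZ n) q c a → rep M q c a q ≡ c a
  rep-eq M q c a rewrite dec-true (q F.≟ q) refl = refl

  rep-ne : ∀ {n} (M : MZ n) q c a b → b ≢ q → rep M q c a b ≡ M a b
  rep-ne M q c a b ne rewrite dec-false (b F.≟ q) ne = refl

  toℕ-punchIn-< : ∀ {n} (j : Fin (suc n)) (b : Fin n) → toℕ b ℕ.< toℕ j → toℕ (punchIn j b) ≡ toℕ b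
  toℕ-punchIn-< zero b ()
  toℕ-punchIn-< (suc j) zero lt = refl
  toℕ-punchIn-< (suc j) (suc b) (s≤s lt) = cong suc (toℕ-punchIn-< j b lt)

  toℕ-punchIn-≥ : ∀ {n} (j : Fin (suc n)) (b : Fin n) → toℕ j ℕ.≤ toℕ b → toℕ (punchIn j b) ≡ suc (toℕ b)
  toℕ-punchIn-≥ zero b le = refl
  toℕ-punchIn-≥ (suc j) zero ()
  toℕ-punchIn-≥ (suc j) (suc b) (s≤s le) = cong suc (toℕ-punchIn-≥ j b le)

  punchOut-col : ∀ {n} (j b : Fin (suc n)) → j ≢ b → Σ (Fin n) λ b' → punchIn j b' ≡ b ×
         ((toℕ b ℕ.< toℕ j → toℕ b' ≡ toℕ b) × (toℕ j ℕ.< toℕ b → suc (toℕ b') ≡ toℕ b))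
  punchOut-col j b ne = b' , e , l1 , l2
    where
    b' = punchOut ne
    e = FP.punchIn-punchOut ne
    l1 : toℕ b ℕ.< toℕ j → toℕ b' ≡ toℕ b
    l1 lt with toℕ b' ℕ.<? toℕ j
    ... | yes lt' = trans (sym (toℕ-punchIn-< j b' lt')) (cong toℕ e)
    ... | no nlt = ⊥-elim (NP.<-irrefl refl (NP.<-trans lt (subst (λ z → toℕ j ℕ.< z)
               (trans (sym (toℕ-punchIn-≥ j b' (NP.≮⇒≥ nlt))) (cong toℕ e)) (s≤s (NP.≮⇒≥ nlt)))))
    l2 : toℕ j ℕ.< toℕ b → suc (toℕ b') ≡ toℕ b
    l2 lt with toℕ b' ℕ.<? toℕ j
    ... | yes lt' = ⊥-elim (NP.<-irrefl refl (NP.<-trans lt (subst (λ z → z ℕ.< toℕ j)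
               (trans (sym (toℕ-punchIn-< j b' lt')) (cong toℕ e)) lt')))
    ... | no nlt = trans (sym (toℕ-punchIn-≥ j b' (NP.≮⇒≥ nlt))) (cong toℕ e)

  private
    linq : ∀ s g x y d → g * ((x + s * y) * d) ≡ g * (x * d) + s * (g * (y * d))
    linq = solve-∀
    linj : ∀ s g x a b → g * (x * (a + s * b)) ≡ g * (x * a) + s * (g * (x * b))
    linj = solve-∀

  det-lin : ∀ {n} (M : MZ n) q (x y : Fin n → ℤ) s →
    detℤ (rep M q (λ a → x a + s * y a)) ≡ detℤ (rep M q x) + s * detℤ (rep M q y)
  det-lin {zero} M () x y s
  det-lin {suc n} M q x y s =
    trans (sum-ext term) (trans (sum-+ (T x) (λ j → s * T y j)) (cong (λ z → sumℤ (T x) + z) (sum-*l s (T y))))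
    where
    T : (Fin (suc n) → ℤ) → Fin (suc n) → ℤ
    T z j = sg j * (rep M q z zero j * detℤ (minor j (rep M q z)))
    term : ∀ j → T (λ a → x a + s * y a) j ≡ T x j + s * T y j
    term j with q F.≟ j
    ... | yes refl = trans (cong₂ (λ u v → sg q * (u * v)) (rep-eq M q (λ a → x a + s * y a) zero) (det-ext (mi (λ a → x a + s * y a))))
              (trans (linq s (sg q) (x zero) (y zero) D)
                (sym (cong₂ _+_ (cong₂ (λ u v → sg q * (u * v)) (rep-eq M q x zero) (det-ext (mi x)))
                     (cong (s *_) (cong₂ (λ u v → sg q * (u * v)) (rep-eq M q y zero) (det-ext (mi y)))))))
      where
      D = detℤ (minor q M)
      mi : ∀ z → ∀ a b → minor q (rep M q z) a b ≡ minor q M a b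
      mi z a b = rep-ne M q z (suc a) (punchIn q b) (FP.punchInᵢ≢i q b)
    ... | no ne' = trans (cong₂ (λ u v → sg j * (u * v)) (rep-ne M q (λ a → x a + s * y a) zero j ne) (det-ext (mi (λ a → x a + s * y a))))
              (trans (cong (λ v → sg j * (M zero j * v)) (det-lin (minor j M) q' (x ∘ suc) (y ∘ suc) s))
              (trans (linj s (sg j) (M zero j) _ _)
                (sym (cong₂ _+_ (cong₂ (λ u v → sg j * (u * v)) (rep-ne M q x zero j ne) (det-ext (mi x)))
                     (cong (s *_) (cong₂ (λ u v → sg j * (u * v)) (rep-ne M q y zero j ne) (det-ext (mi y))))))))
      where
      ne : j ≢ q
      ne e = ne' (sym e)
      po = punchOut-col j q ne
      q' = proj₁ po
      eq' : punchIn j q' ≡ q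
      eq' = proj₁ (proj₂ po)
      mi : ∀ z → ∀ a b → minor j (rep M q z) a b ≡ rep (minor j M) q' (z ∘ suc) a b
      mi z a b with q' F.≟ b
      ... | yes refl = trans (cong (rep M q z (suc a)) eq') (trans (rep-eq M q z (suc a)) (sym (rep-eq (minor j M) q' (z ∘ suc) a)))
      ... | no nb' = trans (rep-ne M q z (suc a) (punchIn j b) (λ e → nb (FP.punchIn-injective j b q' (trans e (sym eq')))))
                    (sym (rep-ne (minor j M) q' (z ∘ suc) a b nb))
        where
        nb : b ≢ q'
        nb e = nb' (sym e)

  sum-two : ∀ {n} (f : Fin n → ℤ) (q r : Fin n) → q ≢ r → (∀ j → j ≢ q → j ≢ r → f j ≡ 0ℤ) → sumℤ f ≡ f q + f r
  sum-two {n} f q r qr e =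
    trans (sum-pick f g1 q (g1q) (λ i ne → g1ne i ne))
          (cong (λ z → f q + z) (trans (sum-pt g1 r (λ i ne → g10 i ne)) (g1ne r (λ e' → qr (sym e')))))
    where
    g1 : Fin n → ℤ
    g1 j = if does (j F.≟ q) then 0ℤ else f j
    g1q : g1 q ≡ 0ℤ
    g1q rewrite dec-true (q F.≟ q) refl = refl
    g1ne : ∀ i → i ≢ q → g1 i ≡ f i
    g1ne i ne rewrite dec-false (i F.≟ q) ne = refl
    g10 : ∀ i → i ≢ r → g1 i ≡ 0ℤ
    g10 i ne with i F.≟ q
    ... | yes _ = refl
    ... | no ne' = e i ne' ne

  sg-suc : ∀ {n} (q r : Fin n) → toℕ r ≡ suc (toℕ q) → sg r ≡ - 1ℤ * sg q
  sg-suc q r e rewrite e = refl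

  private
    cofactors-cancel : ∀ s x d → s * (x * d) + (- 1ℤ * s) * (x * d) ≡ 0ℤ
    cofactors-cancel = solve-∀

  -- two equal adjacent columns give determinant 0 (induction on n: the two
  -- corresponding cofactors cancel, all other minors again have equal adjacent columns)
  alt-adj : ∀ {n} (M : MZ n) (q r : Fin n) → toℕ r ≡ suc (toℕ q) → (∀ a → M a q ≡ M a r) → detℤ M ≡ 0ℤ
  alt-adj {zero} M () r e h
  alt-adj {suc n} M q r e h = trans (sum-two f q r qr otherCofactors)
     (trans (cong₂ (λ u v → f q + sg r * (u * v)) (sym (h zero)) (sym (det-ext sameMinors)))
      (trans (cong (λ u → f q + u * (M zero q * detℤ (minor q M))) (sg-suc q r e)) (cofactors-cancel (sg q) (M zero q) _)))
    where
    f : Fin (suc n) → ℤ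
    f j = sg j * (M zero j * detℤ (minor j M))
    qr : q ≢ r
    qr eq = NP.<-irrefl (trans (cong toℕ eq) e) (NP.n<1+n (toℕ q))
    sameMinors : ∀ a b → minor q M a b ≡ minor r M a b
    sameMinors a b with NP.<-cmp (toℕ b) (toℕ q)
    ... | tri< lt _ _ = cong (M (suc a)) (FP.toℕ-injective (trans (toℕ-punchIn-< q b lt) (sym (toℕ-punchIn-< r b (NP.<-trans lt (subst (toℕ q ℕ.<_) (sym e) (NP.n<1+n _)))))))
    ... | tri≈ _ eb _ = trans (cong (M (suc a)) (FP.toℕ-injective (trans (toℕ-punchIn-≥ q b (NP.≤-reflexive (sym eb))) (trans (cong suc eb) (sym e)))))
                            (trans (sym (h (suc a))) (cong (M (suc a)) (FP.toℕ-injective (trans (sym eb) (sym (toℕ-punchIn-< r b (subst (toℕ b ℕ.<_) (sym e) (subst (λ z → toℕ b ℕ.< suc z) eb (NP.n<1+n _)))))))))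
    ... | tri> _ _ gt = cong (M (suc a)) (FP.toℕ-injective (trans (toℕ-punchIn-≥ q b (NP.<⇒≤ gt)) (sym (toℕ-punchIn-≥ r b (subst (ℕ._≤ toℕ b) (sym e) gt)))))
    otherCofactors : ∀ j → j ≢ q → j ≢ r → f j ≡ 0ℤ
    otherCofactors j jq jr = trans (cong (λ z → sg j * (M zero j * z)) (alt-adj (minor j M) q' r' adj col)) (lem (sg j) (M zero j))
      where
      lem : ∀ a b → a * (b * 0ℤ) ≡ 0ℤ
      lem = solve-∀
      poq = punchOut-col j q jq
      por = punchOut-col j r jr
      q' = proj₁ poq
      r' = proj₁ por
      col : ∀ a → minor j M a q' ≡ minor j M a r'
      col a = trans (cong (M (suc a)) (proj₁ (proj₂ poq))) (trans (h (suc a)) (sym (cong (M (suc a)) (proj₁ (proj₂ por)))))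
      jq' : toℕ j ≢ toℕ q
      jq' z = jq (FP.toℕ-injective z)
      jr' : toℕ j ≢ toℕ r
      jr' z = jr (FP.toℕ-injective z)
      adj : toℕ r' ≡ suc (toℕ q')
      adj with NP.<-cmp (toℕ j) (toℕ q)
      ... | tri< lt _ _ = NP.suc-injective (trans (proj₂ (proj₂ (proj₂ por)) (NP.<-trans lt (subst (toℕ q ℕ.<_) (sym e) (NP.n<1+n _))))
                     (trans e (cong suc (sym (proj₂ (proj₂ (proj₂ poq)) lt)))))
      ... | tri≈ _ eq _ = ⊥-elim (jq' eq)
      ... | tri> _ _ gt = trans (proj₁ (proj₂ (proj₂ por)) rj) (trans e (cong suc (sym (proj₁ (proj₂ (proj₂ poq)) gt))))
        where
        rj : toℕ r ℕ.< toℕ j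
        rj = NP.≤∧≢⇒< (subst (ℕ._≤ toℕ j) (sym e) gt) (λ z → jr' (sym z))

  colSwap : ∀ {n} → MZ n → Fin n → Fin n → MZ n
  colSwap M q r a b = if does (b F.≟ q) then M a r else (if does (b F.≟ r) then M a q else M a b)

  two-columns-ext : ∀ {n} (q r : Fin n) (N N' : MZ n) → (∀ a → N a q ≡ N' a q) → (∀ a → N a r ≡ N' a r) →
        (∀ a b → b ≢ q → b ≢ r → N a b ≡ N' a b) → ∀ a b → N a b ≡ N' a b
  two-columns-ext q r N N' hq hr ho a b with q F.≟ b | r F.≟ b
  ... | yes refl | _ = hq a
  ... | no _ | yes refl = hr a
  ... | no nq | no nr = ho a b (λ z → nq (sym z)) (λ z → nr (sym z))

  module TwoColumns {n} (M : MZ n) (q r : Fin n) (qr : q ≢ r) where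
    rq : ∀ x y a → rep (rep M q x) r y a q ≡ x a
    rq x y a = trans (rep-ne (rep M q x) r y a q qr) (rep-eq M q x a)
    rr : ∀ x y a → rep (rep M q x) r y a r ≡ y a
    rr x y a = rep-eq (rep M q x) r y a
    ro : ∀ x y a b → b ≢ q → b ≢ r → rep (rep M q x) r y a b ≡ M a b
    ro x y a b bq br = trans (rep-ne (rep M q x) r y a b br) (rep-ne M q x a b bq)
    rq' : ∀ x y a → rep (rep M r y) q x a q ≡ x a
    rq' x y a = rep-eq (rep M r y) q x a
    rr' : ∀ x y a → rep (rep M r y) q x a r ≡ y a
    rr' x y a = trans (rep-ne (rep M r y) q x a r (λ z → qr (sym z))) (rep-eq M r y a)
    ro' : ∀ x y a b → b ≢ q → b ≢ r → rep (rep M r y) q x a b ≡ M a b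
    ro' x y a b bq br = trans (rep-ne (rep M r y) q x a b bq) (rep-ne M r y a b br)
    comm : ∀ x y a b → rep (rep M r y) q x a b ≡ rep (rep M q x) r y a b
    comm x y = two-columns-ext q r _ _ (λ a → trans (rq' x y a) (sym (rq x y a))) (λ a → trans (rr' x y a) (sym (rr x y a)))
                (λ a b bq br → trans (ro' x y a b bq br) (sym (ro x y a b bq br)))
    sq : ∀ a → colSwap M q r a q ≡ M a r
    sq a rewrite dec-true (q F.≟ q) refl = refl
    sr : ∀ a → colSwap M q r a r ≡ M a q
    sr a rewrite dec-false (r F.≟ q) (λ z → qr (sym z)) | dec-true (r F.≟ r) refl = refl
    so : ∀ a b → b ≢ q → b ≢ r → colSwap M q r a b ≡ M a b
    so a b bq br rewrite dec-false (b F.≟ q) bq | dec-false (b F.≟ r) br = refl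

  -- exchanging two adjacent columns changes the sign (expand the alternating
  -- form at the matrix whose columns q, r both equal col q + col r)
  swap-adj : ∀ {n} (M : MZ n) (q r : Fin n) → toℕ r ≡ suc (toℕ q) → detℤ (colSwap M q r) ≡ - detℤ M
  swap-adj {n} M q r e = fin (detℤ M) (detℤ (colSwap M q r))
      (trans (sym A0) (trans Aexp (cong₂ (λ u v → u + 1ℤ * v) (cong₂ (λ u v → u + 1ℤ * v) z11 w12) (cong₂ (λ u v → u + 1ℤ * v) w21 z22))))
    where
    open TwoColumns M q r (λ eq → NP.<-irrefl (trans (cong toℕ eq) e) (NP.n<1+n (toℕ q)))
    c1 c2 c12 : Fin n → ℤ
    c1 a = M a q
    c2 a = M a r
    c12 a = c1 a + 1ℤ * c2 a
    W : (Fin n → ℤ) → (Fin n → ℤ) → MZ n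
    W x y = rep (rep M q x) r y
    A0 : detℤ (W c12 c12) ≡ 0ℤ
    A0 = alt-adj (W c12 c12) q r e (λ a → trans (rq c12 c12 a) (sym (rr c12 c12 a)))
    splitr : ∀ x → detℤ (W x c12) ≡ detℤ (W x c1) + 1ℤ * detℤ (W x c2)
    splitr x = det-lin (rep M q x) r c1 c2 1ℤ
    Aexp : detℤ (W c12 c12) ≡ (detℤ (W c1 c1) + 1ℤ * detℤ (W c1 c2)) + 1ℤ * (detℤ (W c2 c1) + 1ℤ * detℤ (W c2 c2))
    Aexp = trans (det-ext (λ a b → sym (comm c12 c12 a b)))
           (trans (det-lin (rep M r c12) q c1 c2 1ℤ)
           (trans (cong₂ (λ u v → u + 1ℤ * v) (det-ext (comm c1 c12)) (det-ext (comm c2 c12)))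
           (cong₂ (λ u v → u + 1ℤ * v) (splitr c1) (splitr c2))))
    z11 : detℤ (W c1 c1) ≡ 0ℤ
    z11 = alt-adj (W c1 c1) q r e (λ a → trans (rq c1 c1 a) (sym (rr c1 c1 a)))
    z22 : detℤ (W c2 c2) ≡ 0ℤ
    z22 = alt-adj (W c2 c2) q r e (λ a → trans (rq c2 c2 a) (sym (rr c2 c2 a)))
    w12 : detℤ (W c1 c2) ≡ detℤ M
    w12 = det-ext (two-columns-ext q r _ _ (rq c1 c2) (rr c1 c2) (ro c1 c2))
    w21 : detℤ (W c2 c1) ≡ detℤ (colSwap M q r)
    w21 = det-ext (two-columns-ext q r _ _ (λ a → trans (rq c2 c1 a) (sym (sq a))) (λ a → trans (rr c2 c1 a) (sym (sr a)))
                    (λ a b bq br → trans (ro c2 c1 a b bq br) (sym (so a b bq br))))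
    fin : ∀ D S → 0ℤ ≡ (0ℤ + 1ℤ * D) + 1ℤ * (S + 1ℤ * 0ℤ) → S ≡ - D
    fin D S h = trans (lem D S) (trans (cong (λ z → - D + z) (sym h)) (ℤP.+-identityʳ _))
      where
      lem : ∀ D S → S ≡ - D + ((0ℤ + 1ℤ * D) + 1ℤ * (S + 1ℤ * 0ℤ))
      lem = solve-∀

  -- two equal columns (at distance d+1) give determinant 0: move one next to
  -- the other by adjacent exchanges
  alt-gen : ∀ d {n} (M : MZ n) (q r : Fin n) → toℕ r ≡ toℕ q ℕ.+ suc d → (∀ a → M a q ≡ M a r) → detℤ M ≡ 0ℤ
  alt-gen zero M q r e h = alt-adj M q r (trans e (NP.+-comm (toℕ q) 1)) h
  alt-gen (suc d) {suc n} M q zero e h = ⊥-elim (NP.0≢1+n (trans e (NP.+-suc (toℕ q) (suc d))))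
  alt-gen (suc d) {suc n} M q (suc r0) e h =
    trans (sym (ℤP.neg-involutive _)) (trans (cong -_ (sym sw)) (trans (cong -_ ih) refl))
    where
    r' = F.inject₁ r0
    r = suc r0
    er : toℕ r ≡ suc (toℕ r')
    er = cong suc (sym (FP.toℕ-inject₁ r0))
    er' : toℕ r' ≡ toℕ q ℕ.+ suc d
    er' = NP.suc-injective (trans (sym er) (trans e (NP.+-suc (toℕ q) (suc d))))
    r'r : r' ≢ r
    r'r z = NP.<-irrefl (trans (cong toℕ z) er) (NP.n<1+n _)
    open TwoColumns M r' r r'r
    sw : detℤ (colSwap M r' r) ≡ - detℤ M
    sw = swap-adj M r' r er
    qr' : q ≢ r'
    qr' z = NP.<-irrefl (trans (cong toℕ z) er') (NP.m<m+n (toℕ q) (s≤s z≤n))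
    qr : q ≢ r
    qr z = NP.<-irrefl (trans (cong toℕ z) (trans er (cong suc er'))) (NP.<-trans (NP.m<m+n (toℕ q) (s≤s z≤n)) (NP.n<1+n _))
    ih : detℤ (colSwap M r' r) ≡ 0ℤ
    ih = alt-gen d (colSwap M r' r) q r' er' (λ a → trans (so a q qr' qr) (trans (h a) (sym (sq a))))

  det-addCol0 : ∀ {n} (N : MZ (suc n)) (q : Fin n) s →
    detℤ (rep N (suc q) (λ a → N a (suc q) + s * N a zero)) ≡ detℤ N
  det-addCol0 N q s =
    trans (det-lin N (suc q) colq col0 s) (trans (cong₂ (λ u v → u + s * v) (det-ext self) equalCols) (lem (detℤ N) s))
    where
    colq col0 : Fin _ → ℤ
    colq a = N a (suc q)
    col0 a = N a zero
    self : ∀ a b → rep N (suc q) colq a b ≡ N a b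
    self a b with suc q F.≟ b
    ... | yes refl = rep-eq N (suc q) colq a
    ... | no ne = rep-ne N (suc q) colq a b (λ z → ne (sym z))
    equalCols : detℤ (rep N (suc q) col0) ≡ 0ℤ
    equalCols = alt-gen (toℕ q) (rep N (suc q) col0) zero (suc q) refl
                  (λ a → trans (rep-ne N (suc q) col0 a zero (λ ())) (sym (rep-eq N (suc q) col0 a)))
    lem : ∀ D s → D + s * 0ℤ ≡ D
    lem = solve-∀

  cop : ∀ {n} → MZ (suc n) → (Fin n → ℤ) → MZ (suc n)
  cop M c a zero = M a zero
  cop M c a (suc b) = M a (suc b) + c b * M a zero

  restrict : ∀ {n} → (Fin n → ℤ) → ℕ → Fin n → ℤ
  restrict c k b = if ⌊ toℕ b ℕ.<? k ⌋ then c b else 0ℤ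

  restrict-< : ∀ {n} (c : Fin n → ℤ) k b → toℕ b ℕ.< k → restrict c k b ≡ c b
  restrict-< c k b l rewrite isYes-t (toℕ b ℕ.<? k) l = refl

  restrict-≮ : ∀ {n} (c : Fin n → ℤ) k b → ¬ (toℕ b ℕ.< k) → restrict c k b ≡ 0ℤ
  restrict-≮ c k b l rewrite isYes-f (toℕ b ℕ.<? k) l = refl

  restrict-other : ∀ {n} (c : Fin n → ℤ) (q b : Fin n) → b ≢ q →
    restrict c (suc (toℕ q)) b ≡ restrict c (toℕ q) b
  restrict-other c q b ne with NP.<-cmp (toℕ b) (toℕ q)
  ... | tri< lt _ _ = trans (restrict-< c _ b (NP.m<n⇒m<1+n lt)) (sym (restrict-< c _ b lt))
  ... | tri≈ _ eq _ = ⊥-elim (ne (FP.toℕ-injective eq))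
  ... | tri> _ _ gt = trans (restrict-≮ c _ b (NP.<⇒≱ (s≤s gt))) (sym (restrict-≮ c _ b (NP.<⇒≯ gt)))

  cop-restrict-step : ∀ {n} (M : MZ (suc n)) (c : Fin n → ℤ) (q : Fin n) →
    let N = cop M (restrict c (toℕ q)) in
    ∀ a b → cop M (restrict c (suc (toℕ q))) a b ≡ rep N (suc q) (λ a → N a (suc q) + c q * N a zero) a b
  cop-restrict-step M c q a zero = refl
  cop-restrict-step M c q a (suc b) with b F.≟ q
  ... | yes refl =
    begin
      M a (suc q) + restrict c (suc (toℕ q)) q * M a zero ≡⟨ cong (λ z → M a (suc q) + z * M a zero) (restrict-< c _ q NP.≤-refl) ⟩
      M a (suc q) + c q * M a zero                        ≡⟨ lem (M a (suc q)) (c q * M a zero) (M a zero) ⟩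
      (M a (suc q) + 0ℤ * M a zero) + c q * M a zero      ≡⟨ cong (λ z → (M a (suc q) + z * M a zero) + c q * M a zero)
                                                              (sym (restrict-≮ c _ q (NP.<-irrefl refl))) ⟩
      (M a (suc q) + restrict c (toℕ q) q * M a zero) + c q * M a zero ∎
    where
    open ≡-Reasoning
    lem : ∀ x y z → x + y ≡ (x + 0ℤ * z) + y
    lem = solve-∀
  ... | no ne = cong (λ z → M a (suc b) + z * M a zero) (restrict-other c q b ne)

  det-cop-restrict : ∀ {n} (M : MZ (suc n)) (c : Fin n → ℤ) k → k ℕ.≤ n → detℤ (cop M (restrict c k)) ≡ detℤ M
  det-cop-restrict {n} M c zero _ = det-ext col
    where
    col : ∀ a b → cop M (restrict c 0) a b ≡ M a b
    col a zero = refl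
    col a (suc b) = trans (cong (λ z → M a (suc b) + z * M a zero) (restrict-≮ c 0 b (λ ()))) (ℤP.+-identityʳ _)
  det-cop-restrict {n} M c (suc k) le =
    subst (λ j → detℤ (cop M (restrict c (suc j))) ≡ detℤ M) (FP.toℕ-fromℕ< le) step
    where
    q : Fin n
    q = F.fromℕ< le
    N = cop M (restrict c (toℕ q))
    step : detℤ (cop M (restrict c (suc (toℕ q)))) ≡ detℤ M
    step = begin
      detℤ (cop M (restrict c (suc (toℕ q))))                     ≡⟨ det-ext (cop-restrict-step M c q) ⟩
      detℤ (rep N (suc q) (λ a → N a (suc q) + c q * N a zero))   ≡⟨ det-addCol0 N q (c q) ⟩
      detℤ N                                                      ≡⟨ cong (λ j → detℤ (cop M (restrict c j))) (FP.toℕ-fromℕ< le) ⟩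
      detℤ (cop M (restrict c k))                                 ≡⟨ det-cop-restrict M c k (NP.<⇒≤ le) ⟩
      detℤ M ∎
      where open ≡-Reasoning

  det-cop : ∀ {n} (M : MZ (suc n)) (c : Fin n → ℤ) → detℤ (cop M c) ≡ detℤ M
  det-cop {n} M c = trans (det-ext full) (det-cop-restrict M c n NP.≤-refl)
    where
    full : ∀ a b → cop M c a b ≡ cop M (restrict c n) a b
    full a zero = refl
    full a (suc b) = cong (λ z → M a (suc b) + z * M a zero) (sym (restrict-< c n b (FP.toℕ<n b)))

  schurM : ∀ {n} → MZ (suc n) → ℤ → MZ n
  schurM g iA a b = g (suc a) (suc b) - g (suc a) zero * iA * g zero (suc b)

  -- det g ≡ g₀₀ · det(Schur complement): clear row 0 by column operations, then expand
  det-schur : ∀ {m n} (g : MZ (suc n)) (iA : ℤ) → Cg m (g zero zero * iA) 1ℤ →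
              Cg m (detℤ g) (g zero zero * detℤ (schurM g iA))
  det-schur {m} {n} g iA h =
    cg-trans (cg-≡ (sym (det-cop g c)))
      (cg-trans (cg-+ (cg-≡ pivotTerm) (sum-cg0 _ otherTerms)) (cg-≡ (ℤP.+-identityʳ _)))
    where
    A = g zero zero
    c : Fin n → ℤ
    c j = - (iA * g zero (suc j))
    G = cop g c
    l₁ : ∀ x y i z → x + - (i * z) * y ≡ x - y * i * z
    l₁ = solve-∀
    pivotTerm : 1ℤ * (A * detℤ (minor zero G)) ≡ A * detℤ (schurM g iA)
    pivotTerm = trans (ℤP.*-identityˡ _)
      (cong (A *_) (det-ext (λ a b → l₁ (g (suc a) (suc b)) (g (suc a) zero) iA (g zero (suc b)))))
    l₂ : ∀ x i A → x + - (i * x) * A ≡ x * (1ℤ - A * i)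
    l₂ = solve-∀
    l₃ : ∀ s x D → s * (x * 0ℤ * D) ≡ 0ℤ
    l₃ = solve-∀
    -- after the column operations, row 0 is ≡ (A, 0, …, 0)
    otherTerms : ∀ j → Cg m (sg (suc j) * (G zero (suc j) * detℤ (minor (suc j) G))) 0ℤ
    otherTerms j =
      cg-trans (cg-≡ (cong (λ z → sg (suc j) * (z * detℤ (minor (suc j) G))) (l₂ (g zero (suc j)) iA A)))
        (cg-trans (cg-* (cg-refl {a = sg (suc j)}) (cg-* (cg-* (cg-refl {a = g zero (suc j)}) e0) (cg-refl {a = detℤ (minor (suc j) G)})))
          (cg-≡ (l₃ (sg (suc j)) (g zero (suc j)) (detℤ (minor (suc j) G)))))
      where
      e0 : Cg m (1ℤ - A * iA) 0ℤ
      e0 = cg-+ (cg-refl {a = 1ℤ}) (cg-neg h)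

open Determinant

module IntegerMatrices where

  open import Data.Integer using (_+_; _*_; _-_)

  δZ : ∀ {n} → Fin n → Fin n → ℤ
  δZ a b = if ⌊ a F.≟ b ⌋ then 1ℤ else 0ℤ

  EZ : ∀ {n} → Fin n → Fin n → Fin n → Fin n → ℤ
  EZ i j a b = if ⌊ a F.≟ i ⌋ ∧ ⌊ b F.≟ j ⌋ then 1ℤ else 0ℤ

  xZ : ∀ {n} → Fin n → Fin n → ℤ → MZ n
  xZ i j t a b = δZ a b + t * EZ i j a b

  hZ : ∀ {n} → ℕ → Fin n → Fin n → ℤ → MZ n
  hZ k i j v a b =
    if ⌊ a F.≟ b ⌋
    then (if ⌊ a F.≟ i ⌋ then 1ℤ + v else if ⌊ a F.≟ j ⌋ then geom (- v) k else 1ℤ)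
    else 0ℤ

  mulZ : ∀ {n} → MZ n → MZ n → MZ n
  mulZ A B a b = sumℤ (λ c → A a c * B c b)

  prodZ : ∀ {n} → List (MZ n) → MZ n
  prodZ = foldr mulZ δZ

  CZ : ℕ → Set
  CZ n = Fin n → Fin n → ℤ

  LZ : ∀ {n} → CZ n → MZ n
  LZ {n} u = prodZ (map (λ r → xZ (proj₁ r) (proj₂ r) (u (proj₁ r) (proj₂ r))) (negRoots n))

  HZ : ∀ {n} → ℕ → CZ n → MZ n
  HZ {n} k v = prodZ (map (λ r → hZ k (proj₁ r) (proj₂ r) (v (proj₁ r) (proj₂ r))) (simpleRoots n))

  UZ : ∀ {n} → CZ n → MZ n
  UZ {n} w = prodZ (map (λ r → xZ (proj₁ r) (proj₂ r) (w (proj₁ r) (proj₂ r))) (posRoots n))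

  decZ : ∀ {n} → ℕ → CZ n → CZ n → CZ n → MZ n
  decZ k u v w = mulZ (mulZ (LZ u) (HZ k v)) (UZ w)

  δ-eq : ∀ {n} (a : Fin n) → δZ a a ≡ 1ℤ
  δ-eq a rewrite isYes-t (a F.≟ a) refl = refl

  δ-ne : ∀ {n} (a b : Fin n) → a ≢ b → δZ a b ≡ 0ℤ
  δ-ne a b ne rewrite isYes-f (a F.≟ b) ne = refl

  E-eq : ∀ {n} (i j : Fin n) → EZ i j i j ≡ 1ℤ
  E-eq i j rewrite isYes-t (i F.≟ i) refl | isYes-t (j F.≟ j) refl = refl

  E-ne1 : ∀ {n} (i j a b : Fin n) → a ≢ i → EZ i j a b ≡ 0ℤ
  E-ne1 i j a b ne rewrite isYes-f (a F.≟ i) ne = refl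

  E-ne2 : ∀ {n} (i j a b : Fin n) → b ≢ j → EZ i j a b ≡ 0ℤ
  E-ne2 i j a b ne with ⌊ a F.≟ i ⌋
  ... | false = refl
  ... | true rewrite isYes-f (b F.≟ j) ne = refl

  mulZ-ext : ∀ {n} {A A' B B' : MZ n} → (∀ a b → A a b ≡ A' a b) → (∀ a b → B a b ≡ B' a b) → ∀ a b → mulZ A B a b ≡ mulZ A' B' a b
  mulZ-ext eA eB a b = sum-ext (λ c → cong₂ _*_ (eA a c) (eB c b))

  mulZ-cg : ∀ {m n} {A A' B B' : MZ n} → (∀ a b → Cg m (A a b) (A' a b)) → (∀ a b → Cg m (B a b) (B' a b)) → ∀ a b → Cg m (mulZ A B a b) (mulZ A' B' a b)
  mulZ-cg eA eB a b = sum-cg (λ c → cg-* (eA a c) (eB c b))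

  prodZ-cg : ∀ {n} {M} {A : Set} (F F' : A → MZ n) (S : List A) → All (λ r → ∀ a b → Cg M (F r a b) (F' r a b)) S →
    ∀ a b → Cg M (prodZ (map F S) a b) (prodZ (map F' S) a b)
  prodZ-cg F F' [] _ a b = cg-refl
  prodZ-cg F F' (r ∷ S) (h ∷ hs) a b = mulZ-cg h (prodZ-cg F F' S hs) a b

  sum-δl : ∀ {n} (a : Fin n) (f : Fin n → ℤ) → sumℤ (λ c → δZ a c * f c) ≡ f a
  sum-δl a f = trans (sum-pt (λ c → δZ a c * f c) a (λ c ne → trans (cong (_* f c) (δ-ne a c (λ e → ne (sym e)))) (ℤP.*-zeroˡ (f c))))
                     (trans (cong (_* f a) (δ-eq a)) (ℤP.*-identityˡ (f a)))

  sum-Ej : ∀ {n} (i j : Fin n) (f : Fin n → ℤ) → sumℤ (λ c → EZ i j i c * f c) ≡ f j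
  sum-Ej i j f = trans (sum-pt (λ c → EZ i j i c * f c) j (λ c ne → trans (cong (_* f c) (E-ne2 i j i c ne)) (ℤP.*-zeroˡ (f c))))
                     (trans (cong (_* f j) (E-eq i j)) (ℤP.*-identityˡ (f j)))

  sum-Ene : ∀ {n} (i j a : Fin n) (f : Fin n → ℤ) → a ≢ i → sumℤ (λ c → EZ i j a c * f c) ≡ 0ℤ
  sum-Ene {n} i j a f ne = trans (sum-ext (λ c → trans (cong (_* f c) (E-ne1 i j a c ne)) (ℤP.*-zeroˡ (f c)))) (sum-0 {n})

  private
    dist : ∀ d t e p → (d + t * e) * p ≡ d * p + t * (e * p)
    dist = solve-∀

  rowop : ∀ {n} (i j : Fin n) t (P : MZ n) a b →
    mulZ (xZ i j t) P a b ≡ P a b + t * sumℤ (λ c → EZ i j a c * P c b)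
  rowop i j t P a b = trans (sum-ext (λ c → dist (δZ a c) t (EZ i j a c) (P c b)))
     (trans (sum-+ (λ c → δZ a c * P c b) (λ c → t * (EZ i j a c * P c b))) (cong₂ _+_ (sum-δl a (λ c → P c b)) (sum-*l t (λ c → EZ i j a c * P c b))))

  rowop-eq : ∀ {n} (i j : Fin n) t (P : MZ n) b → mulZ (xZ i j t) P i b ≡ P i b + t * P j b
  rowop-eq i j t P b = trans (rowop i j t P i b) (cong (λ z → P i b + t * z) (sum-Ej i j (λ c → P c b)))

  rowop-ne : ∀ {n} (i j : Fin n) t (P : MZ n) a b → a ≢ i → mulZ (xZ i j t) P a b ≡ P a b
  rowop-ne i j t P a b ne = trans (rowop i j t P a b) (trans (cong (λ z → P a b + t * z) (sum-Ene i j a (λ c → P c b) ne))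
     (trans (cong (λ z → P a b + z) (ℤP.*-zeroʳ t)) (ℤP.+-identityʳ _)))

  mul-diag : ∀ {n} (D P : MZ n) → (∀ a c → a ≢ c → D a c ≡ 0ℤ) → ∀ a b → mulZ D P a b ≡ D a a * P a b
  mul-diag D P h a b = sum-pt (λ c → D a c * P c b) a (λ c ne → trans (cong (_* P c b) (h a c (λ e → ne (sym e)))) (ℤP.*-zeroˡ (P c b)))

  mul-diagR : ∀ {n} (P D : MZ n) → (∀ a c → a ≢ c → D a c ≡ 0ℤ) → ∀ a b → mulZ P D a b ≡ P a b * D b b
  mul-diagR P D h a b = sum-pt (λ c → P a c * D c b) b (λ c ne → trans (cong (P a c *_) (h c b ne)) (ℤP.*-zeroʳ (P a c)))

  if-app : ∀ (c : Bool) (f g : Seq) k → (if c then f else g) k ≡ (if c then f k else g k)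
  if-app true f g k = refl
  if-app false f g k = refl

  lv-sum : ∀ {m} (f : Fin m → Seq) k → sumₚ f k ≡ sumℤ (λ c → f c k)
  lv-sum {zero} f k = refl
  lv-sum {suc m} f k = cong (λ z → f zero k + z) (lv-sum (λ i → f (suc i)) k)

  lvM : ∀ {n} → Mat n → ℕ → MZ n
  lvM M k a b = M a b k

  lv-δ : ∀ {n} (a b : Fin n) k → Id a b k ≡ δZ a b
  lv-δ a b k = if-app ⌊ a F.≟ b ⌋ 1ₚ 0ₚ k

  lv-E : ∀ {n} (i j a b : Fin n) k → E i j a b k ≡ EZ i j a b
  lv-E i j a b k = if-app (⌊ a F.≟ i ⌋ ∧ ⌊ b F.≟ j ⌋) 1ₚ 0ₚ k

  lv-x : ∀ {n} (i j : Fin n) t a b k → x i j t a b k ≡ xZ i j (t k) a b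
  lv-x i j t a b k = cong₂ _+_ (lv-δ a b k) (cong (t k *_) (lv-E i j a b k))

  lv-h : ∀ {n} (i j : Fin n) v a b k → h1+ i j v a b k ≡ hZ k i j (v k) a b
  lv-h i j v a b k with ⌊ a F.≟ b ⌋ | ⌊ a F.≟ i ⌋ | ⌊ a F.≟ j ⌋
  ... | false | _ | _ = refl
  ... | true | true | _ = refl
  ... | true | false | true = refl
  ... | true | false | false = refl

  lv-mul : ∀ {n} (M N : Mat n) a b k → (M · N) a b k ≡ mulZ (lvM M k) (lvM N k) a b
  lv-mul M N a b k = lv-sum (λ c → M a c *ₚ N c b) k

  lv-prod : ∀ {n} {A : Set} (f : A → Mat n) (F : A → MZ n) k → (∀ r a b → f r a b k ≡ F r a b) →
    ∀ rs a b → prodM (map f rs) a b k ≡ prodZ (map F rs) a b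
  lv-prod f F k e [] a b = lv-δ a b k
  lv-prod f F k e (r ∷ rs) a b = trans (lv-mul (f r) (prodM (map f rs)) a b k) (mulZ-ext (e r) (lv-prod f F k e rs) a b)

  lvC : ∀ {n} → Coords n → ℕ → CZ n
  lvC u k i j = u i j k

  lv-decomp : ∀ {n} (u v w : Coords n) k a b → decomp u v w a b k ≡ decZ k (lvC u k) (lvC v k) (lvC w k) a b
  lv-decomp {n} u v w k a b =
    trans (lv-mul (Lm · Hm) Um a b k) (mulZ-ext (λ a b → trans (lv-mul Lm Hm a b k) (mulZ-ext lvL lvH a b)) lvU a b)
    where
    fx fh fw : Root n → Mat n
    fx r = x (proj₁ r) (proj₂ r) (u (proj₁ r) (proj₂ r))
    fh r = h1+ (proj₁ r) (proj₂ r) (v (proj₁ r) (proj₂ r))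
    fw r = x (proj₁ r) (proj₂ r) (w (proj₁ r) (proj₂ r))
    Lm Hm Um : Mat n
    Lm = prodM (map fx (negRoots n))
    Hm = prodM (map fh (simpleRoots n))
    Um = prodM (map fw (posRoots n))
    lvL : ∀ a b → Lm a b k ≡ LZ (lvC u k) a b
    lvL = lv-prod fx (λ r → xZ (proj₁ r) (proj₂ r) (u (proj₁ r) (proj₂ r) k)) k
                  (λ r a b → lv-x (proj₁ r) (proj₂ r) (u (proj₁ r) (proj₂ r)) a b k) (negRoots n)
    lvH : ∀ a b → Hm a b k ≡ HZ k (lvC v k) a b
    lvH = lv-prod fh (λ r → hZ k (proj₁ r) (proj₂ r) (v (proj₁ r) (proj₂ r) k)) k
                  (λ r a b → lv-h (proj₁ r) (proj₂ r) (v (proj₁ r) (proj₂ r)) a b k) (simpleRoots n)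
    lvU : ∀ a b → Um a b k ≡ UZ (lvC w k) a b
    lvU = lv-prod fw (λ r → xZ (proj₁ r) (proj₂ r) (w (proj₁ r) (proj₂ r) k)) k
                  (λ r a b → lv-x (proj₁ r) (proj₂ r) (w (proj₁ r) (proj₂ r)) a b k) (posRoots n)

open IntegerMatrices

-- Every root in negRoots n is negative (similarly
-- for posRoots, simpleRoots), and every negative (positive, simple) root
-- occurs in its list exactly once: cnt (negRoots n) a b ≡ 1.  The count is
-- computed by turning the nested concatMaps into double sums over Fin n.
module RootLists where

  open import Data.List using (_++_; reverse; reverseAcc; allFin; upTo; concatMap; applyUpTo; tabulate)
  open import Data.List.Relation.Unary.All.Properties using (++⁺)

  sumN : ∀ {n} → (Fin n → ℕ) → ℕ
  sumN {zero} f = 0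
  sumN {suc n} f = f zero ℕ.+ sumN (f ∘ suc)

  sumN-ext : ∀ {n} {f g : Fin n → ℕ} → (∀ i → f i ≡ g i) → sumN f ≡ sumN g
  sumN-ext {zero} e = refl
  sumN-ext {suc n} e = cong₂ ℕ._+_ (e zero) (sumN-ext (λ i → e (suc i)))

  sumN-0 : ∀ {n} (f : Fin n → ℕ) → (∀ i → f i ≡ 0) → sumN f ≡ 0
  sumN-0 {zero} f e = refl
  sumN-0 {suc n} f e = cong₂ ℕ._+_ (e zero) (sumN-0 (f ∘ suc) (λ i → e (suc i)))

  sumN-pt : ∀ {n} (f : Fin n → ℕ) (c : Fin n) → (∀ i → i ≢ c → f i ≡ 0) → sumN f ≡ f c
  sumN-pt {suc n} f zero e = trans (cong (f zero ℕ.+_) (sumN-0 (f ∘ suc) (λ i → e (suc i) (λ ())))) (NP.+-identityʳ _)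
  sumN-pt {suc n} f (suc c) e = trans (cong (ℕ._+ sumN (f ∘ suc)) (e zero (λ ()))) (sumN-pt (f ∘ suc) c (λ i ne → e (suc i) (λ q → ne (FP.suc-injective q))))

  sumL : ∀ {A : Set} → (A → ℕ) → List A → ℕ
  sumL h [] = 0
  sumL h (x ∷ xs) = h x ℕ.+ sumL h xs

  sumL-++ : ∀ {A : Set} (h : A → ℕ) xs ys → sumL h (xs ++ ys) ≡ sumL h xs ℕ.+ sumL h ys
  sumL-++ h [] ys = refl
  sumL-++ h (x ∷ xs) ys = trans (cong (h x ℕ.+_) (sumL-++ h xs ys)) (sym (NP.+-assoc (h x) _ _))

  sumL-revAcc : ∀ {A : Set} (h : A → ℕ) acc xs → sumL h (reverseAcc acc xs) ≡ sumL h acc ℕ.+ sumL h xs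
  sumL-revAcc h acc [] = sym (NP.+-identityʳ _)
  sumL-revAcc h acc (x ∷ xs) = trans (sumL-revAcc h (x ∷ acc) xs) (lem (h x) (sumL h acc) (sumL h xs))
    where
    lem : ∀ a b c → (a ℕ.+ b) ℕ.+ c ≡ b ℕ.+ (a ℕ.+ c)
    lem a b c = trans (cong (ℕ._+ c) (NP.+-comm a b)) (NP.+-assoc b a c)

  sumL-rev : ∀ {A : Set} (h : A → ℕ) xs → sumL h (reverse xs) ≡ sumL h xs
  sumL-rev h xs = sumL-revAcc h [] xs

  sumL-tab : ∀ {A : Set} {n} (h : A → ℕ) (f : Fin n → A) → sumL h (tabulate f) ≡ sumN (h ∘ f)
  sumL-tab {n = zero} h f = refl
  sumL-tab {n = suc n} h f = cong (h (f zero) ℕ.+_) (sumL-tab h (f ∘ suc))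

  sumL-allFin : ∀ {n} (h : Fin n → ℕ) → sumL h (allFin n) ≡ sumN h
  sumL-allFin h = sumL-tab h (λ x → x)

  sumL-applyUpTo : ∀ {A : Set} n (h : A → ℕ) (f : ℕ → A) → sumL h (applyUpTo f n) ≡ sumN (λ (x : Fin n) → h (f (toℕ x)))
  sumL-applyUpTo zero h f = refl
  sumL-applyUpTo (suc n) h f = cong (h (f 0) ℕ.+_) (sumL-applyUpTo n h (f ∘ suc))

  sumL-upTo : ∀ n (h : ℕ → ℕ) → sumL h (upTo n) ≡ sumN (λ (x : Fin n) → h (toℕ x))
  sumL-upTo n h = sumL-applyUpTo n h (λ x → x)

  sumL-concatMap : ∀ {A B : Set} (h : B → ℕ) (f : A → List B) xs → sumL h (concatMap f xs) ≡ sumL (λ x → sumL h (f x)) xs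
  sumL-concatMap h f [] = refl
  sumL-concatMap h f (x ∷ xs) = trans (sumL-++ h (f x) (concatMap f xs)) (cong (sumL h (f x) ℕ.+_) (sumL-concatMap h f xs))

  ind : ∀ {n} → Root n → Fin n → Fin n → ℕ
  ind r a b = if ⌊ proj₁ r F.≟ a ⌋ ∧ ⌊ proj₂ r F.≟ b ⌋ then 1 else 0

  cnt : ∀ {n} → List (Root n) → Fin n → Fin n → ℕ
  cnt S a b = sumL (λ r → ind r a b) S

  ind-eq : ∀ {n} (i j : Fin n) → ind (i , j) i j ≡ 1
  ind-eq i j rewrite isYes-t (i F.≟ i) refl | isYes-t (j F.≟ j) refl = refl

  ind-ne1 : ∀ {n} (i j a b : Fin n) → i ≢ a → ind (i , j) a b ≡ 0
  ind-ne1 i j a b ne rewrite isYes-f (i F.≟ a) ne = refl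

  ind-ne2 : ∀ {n} (i j a b : Fin n) → j ≢ b → ind (i , j) a b ≡ 0
  ind-ne2 i j a b ne with ⌊ i F.≟ a ⌋
  ... | false = refl
  ... | true rewrite isYes-f (j F.≟ b) ne = refl

  cnt-ne1 : ∀ {n} (i j : Fin n) S a b → i ≢ a → cnt ((i , j) ∷ S) a b ≡ cnt S a b
  cnt-ne1 i j S a b ne = cong (ℕ._+ cnt S a b) (ind-ne1 i j a b ne)

  cnt-ne2 : ∀ {n} (i j : Fin n) S a b → j ≢ b → cnt ((i , j) ∷ S) a b ≡ cnt S a b
  cnt-ne2 i j S a b ne = cong (ℕ._+ cnt S a b) (ind-ne2 i j a b ne)

  All-concatMap : ∀ {A B : Set} {P : B → Set} (f : A → List B) xs → (∀ x → All P (f x)) → All P (concatMap f xs)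
  All-concatMap f [] h = []
  All-concatMap f (x ∷ xs) h = ++⁺ (h x) (All-concatMap f xs h)

  All-if : ∀ {B Q : Set} {P : B → Set} (d : Dec Q) (y : B) → (Q → P y) → All P (if ⌊ d ⌋ then y ∷ [] else [])
  All-if (yes q) y h = h q ∷ []
  All-if (no _) y h = []

  neg-all : ∀ n → All (λ r → Neg (proj₁ r) (proj₂ r)) (negRoots n)
  neg-all n = All-concatMap _ (reverse (upTo n)) (λ d → All-concatMap _ (allFin n) (λ j → All-concatMap _ (allFin n)
    (λ i → All-if (toℕ i ℕ.≟ suc d ℕ.+ toℕ j) (i , j) (λ e → subst (toℕ j ℕ.<_) (sym e) (s≤s (NP.m≤n+m (toℕ j) d))))))

  pos-all : ∀ n → All (λ r → Pos (proj₁ r) (proj₂ r)) (posRoots n)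
  pos-all n = All-concatMap _ (reverse (allFin n)) (λ i → All-concatMap _ (reverse (allFin n))
    (λ j → All-if (toℕ i ℕ.<? toℕ j) (i , j) (λ lt → lt)))

  simple-all : ∀ n → All (λ r → Simple (proj₁ r) (proj₂ r)) (simpleRoots n)
  simple-all n = All-concatMap _ (allFin n) (λ i → All-concatMap _ (allFin n)
    (λ j → All-if (toℕ j ℕ.≟ suc (toℕ i)) (i , j) (λ e → e)))

  cnt-if : ∀ {n} (c : Bool) (i j a b : Fin n) → cnt (if c then (i , j) ∷ [] else []) a b ≡ (if c then ind (i , j) a b else 0)
  cnt-if true i j a b = NP.+-identityʳ _
  cnt-if false i j a b = refl

  if-zero : ∀ (c : Bool) {x : ℕ} → x ≡ 0 → (if c then x else 0) ≡ 0
  if-zero true e = e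
  if-zero false e = refl

  if-ind : ∀ {n} (c : Bool) (a b : Fin n) → (if c then ind (a , b) a b else 0) ≡ (if c then 1 else 0)
  if-ind true a b = ind-eq a b
  if-ind false a b = refl

  dbl-ij : ∀ {n} (c : Fin n → Fin n → Bool) (a b : Fin n) →
    sumN (λ j → sumN (λ i → sumL (λ r → ind r a b) (if c i j then (i , j) ∷ [] else []))) ≡ (if c a b then 1 else 0)
  dbl-ij {n} c a b = trans (sumN-ext {n} (λ j → sumN-ext (λ i → cnt-if (c i j) i j a b)))
    (trans (sumN-pt {n} _ b (λ j ne → sumN-0 {n} _ (λ i → if-zero (c i j) (ind-ne2 i j a b ne))))
    (trans (sumN-pt {n} _ a (λ i ne → if-zero (c i b) (ind-ne1 i b a b ne)))
     (if-ind (c a b) a b)))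

  dbl-ji : ∀ {n} (c : Fin n → Fin n → Bool) (a b : Fin n) →
    sumN (λ i → sumN (λ j → sumL (λ r → ind r a b) (if c i j then (i , j) ∷ [] else []))) ≡ (if c a b then 1 else 0)
  dbl-ji {n} c a b = trans (sumN-ext {n} (λ i → sumN-ext (λ j → cnt-if (c i j) i j a b)))
    (trans (sumN-pt {n} _ a (λ i ne → sumN-0 {n} _ (λ j → if-zero (c i j) (ind-ne1 i j a b ne))))
    (trans (sumN-pt {n} _ b (λ j ne → if-zero (c a j) (ind-ne2 a j a b ne)))
     (if-ind (c a b) a b)))

  cnt-pos : ∀ n (a b : Fin n) → Pos a b → cnt (posRoots n) a b ≡ 1
  cnt-pos n a b lt =
    trans (sumL-concatMap h0 F (reverse (allFin n)))
    (trans (sumL-rev (λ i → sumL h0 (F i)) (allFin n))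
    (trans (sumL-allFin {n} (λ i → sumL h0 (F i)))
    (trans (sumN-ext {n} (λ i → trans (sumL-concatMap h0 (G i) (reverse (allFin n))) (trans (sumL-rev (λ j → sumL h0 (G i j)) (allFin n)) (sumL-allFin {n} (λ j → sumL h0 (G i j))))))
    (trans (dbl-ji c a b) (cong (λ z → if z then 1 else 0) (isYes-t (toℕ a ℕ.<? toℕ b) lt))))))
    where
    h0 : Root n → ℕ
    h0 r = ind r a b
    c : Fin n → Fin n → Bool
    c i j = ⌊ toℕ i ℕ.<? toℕ j ⌋
    G : Fin n → Fin n → List (Root n)
    G i j = if c i j then (i , j) ∷ [] else []
    F : Fin n → List (Root n)
    F i = concatMap (G i) (reverse (allFin n))

  cnt-simple : ∀ n (a b : Fin n) → Simple a b → cnt (simpleRoots n) a b ≡ 1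
  cnt-simple n a b e =
    trans (sumL-concatMap h0 F (allFin n))
    (trans (sumL-allFin {n} (λ i → sumL h0 (F i)))
    (trans (sumN-ext {n} (λ i → trans (sumL-concatMap h0 (G i) (allFin n)) (sumL-allFin {n} (λ j → sumL h0 (G i j)))))
    (trans (dbl-ji c a b) (cong (λ z → if z then 1 else 0) (isYes-t (toℕ b ℕ.≟ suc (toℕ a)) e)))))
    where
    h0 : Root n → ℕ
    h0 r = ind r a b
    c : Fin n → Fin n → Bool
    c i j = ⌊ toℕ j ℕ.≟ suc (toℕ i) ⌋
    G : Fin n → Fin n → List (Root n)
    G i j = if c i j then (i , j) ∷ [] else []
    F : Fin n → List (Root n)
    F i = concatMap (G i) (allFin n)

  cnt-neg : ∀ n (a b : Fin n) → Neg a b → cnt (negRoots n) a b ≡ 1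
  cnt-neg n a b lt =
    trans (sumL-concatMap h0 F (reverse (upTo n)))
    (trans (sumL-rev (λ d → sumL h0 (F d)) (upTo n))
    (trans (sumL-upTo n (λ d → sumL h0 (F d)))
    (trans (sumN-ext {n} (λ x → trans (sumL-concatMap h0 (Fj (toℕ x)) (allFin n)) (trans (sumL-allFin {n} (λ j → sumL h0 (Fj (toℕ x) j)))
         (trans (sumN-ext {n} (λ j → trans (sumL-concatMap h0 (G (toℕ x) j) (allFin n)) (sumL-allFin {n} (λ i → sumL h0 (G (toℕ x) j i)))))
           (dbl-ij (λ i j → ⌊ toℕ i ℕ.≟ suc (toℕ x) ℕ.+ toℕ j ⌋) a b)))))
    (trans (sumN-pt {n} _ x0 (λ x ne → g0 x ne)) gx0))))
    where
    h0 : Root n → ℕ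
    h0 r = ind r a b
    G : ℕ → Fin n → Fin n → List (Root n)
    G d j i = if ⌊ toℕ i ℕ.≟ suc d ℕ.+ toℕ j ⌋ then (i , j) ∷ [] else []
    Fj : ℕ → Fin n → List (Root n)
    Fj d j = concatMap (G d j) (allFin n)
    F : ℕ → List (Root n)
    F d = concatMap (Fj d) (allFin n)
    d0 = toℕ a ℕ.∸ suc (toℕ b)
    d0< : d0 ℕ.< n
    d0< = NP.≤-<-trans (NP.m∸n≤m (toℕ a) (suc (toℕ b))) (FP.toℕ<n a)
    x0 : Fin n
    x0 = F.fromℕ< d0<
    ex0 : toℕ a ≡ suc (toℕ x0) ℕ.+ toℕ b
    ex0 = trans (sym (NP.m∸n+n≡m lt)) (trans (cong (ℕ._+ suc (toℕ b)) (sym (FP.toℕ-fromℕ< d0<))) (NP.+-suc (toℕ x0) (toℕ b)))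
    gx0 : (if ⌊ toℕ a ℕ.≟ suc (toℕ x0) ℕ.+ toℕ b ⌋ then 1 else 0) ≡ 1
    gx0 rewrite isYes-t (toℕ a ℕ.≟ suc (toℕ x0) ℕ.+ toℕ b) ex0 = refl
    g0 : ∀ x → x ≢ x0 → (if ⌊ toℕ a ℕ.≟ suc (toℕ x) ℕ.+ toℕ b ⌋ then 1 else 0) ≡ 0
    g0 x ne rewrite isYes-f (toℕ a ℕ.≟ suc (toℕ x) ℕ.+ toℕ b) (λ e → ne (FP.toℕ-injective (NP.+-cancelʳ-≡ (toℕ b) (toℕ x) (toℕ x0) (NP.suc-injective (trans (sym e) ex0))))) = refl


open RootLists

-- For a relation T on positions
-- (below the diagonal, or above it) with a height function ht compatible
-- with composition of T-roots, and a list S of T-roots in which every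
-- T-root occurs exactly once:
--   * off T, Pr S u is the identity (Pr-offT);
--   * at a T-position (a,b), Pr S u a b − u a b depends only on coordinates
--     of height < ht a b (rest-local), so by induction on the height
--       Pr S u ≡ Pr S u' on T  ⇒  u ≡ u' on T                 (Solve.uniq),
--     and the iteration  u ↦ u + (ℓ − Pr S u)  solves Pr S u ≡ ℓ on T
--     after B steps                                           (Solve.exist),
--     with coordinates ≡ 0 mod p whenever ℓ is                (Solve.modp).
module UnipotentProducts where

  open import Data.Integer using (_+_; _*_; _-_)

  Pr : ∀ {n} → List (Root n) → CZ n → MZ n
  Pr S u = prodZ (map (λ r → xZ (proj₁ r) (proj₂ r) (u (proj₁ r) (proj₂ r))) S)

  rest : ∀ {n} → List (Root n) → CZ n → Fin n → Fin n → ℤ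
  rest S u a b = Pr S u a b - + cnt S a b * u a b

  private
    l₀ : ∀ d u → d - + 0 * u ≡ d
    l₀ = solve-∀
    l₁ : ∀ p u c → (p + u * 1ℤ) - (1ℤ + c) * u ≡ p - c * u
    l₁ = solve-∀
    l₂ : ∀ p v q c u → (p + v * q) - c * u ≡ (p - c * u) + v * q
    l₂ = solve-∀
    l₃ : ∀ p v → p + v * 0ℤ ≡ p
    l₃ = solve-∀
    l₄ : ∀ q c u → q ≡ (q - c * u) + c * u
    l₄ = solve-∀

  rest-other-row : ∀ {n} (i j : Fin n) S u a b → i ≢ a → rest ((i , j) ∷ S) u a b ≡ rest S u a b
  rest-other-row i j S u a b ne =
    cong₂ (λ z c → z - + c * u a b) (rowop-ne i j (u i j) (Pr S u) a b (λ z → ne (sym z))) (cnt-ne1 i j S a b ne)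

  rest-same-row : ∀ {n} (i j : Fin n) S u b → j ≢ b → rest ((i , j) ∷ S) u i b ≡ rest S u i b + u i j * Pr S u j b
  rest-same-row i j S u b nb =
    trans (cong₂ (λ z c → z - + c * u i b) (rowop-eq i j (u i j) (Pr S u) b) (cnt-ne2 i j S i b nb))
          (l₂ (Pr S u i b) (u i j) (Pr S u j b) (+ cnt S i b) (u i b))

  rest-root : ∀ {n} (i j : Fin n) S u → Pr S u j j ≡ 1ℤ → rest ((i , j) ∷ S) u i j ≡ rest S u i j
  rest-root i j S u e =
    trans (cong₂ (λ z c → z - c * u i j)
                 (trans (rowop-eq i j (u i j) (Pr S u) j) (cong (λ z → Pr S u i j + u i j * z) e))
                 (trans (cong (λ c → + (c ℕ.+ cnt S i j)) (ind-eq i j)) (ℤP.pos-+ 1 (cnt S i j))))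
          (l₁ (Pr S u i j) (u i j) (+ cnt S i j))

  Z0 : ∀ {n} → CZ n
  Z0 _ _ = 0ℤ

  Pr-zero : ∀ {n} (S : List (Root n)) a b → Pr S Z0 a b ≡ δZ a b
  Pr-zero [] a b = refl
  Pr-zero ((i , j) ∷ S) a b with i F.≟ a
  ... | yes refl = trans (rowop-eq i j 0ℤ (Pr S Z0) b)
                         (trans (cong (λ z → Pr S Z0 i b + z) (ℤP.*-zeroˡ (Pr S Z0 j b))) (trans (ℤP.+-identityʳ _) (Pr-zero S i b)))
  ... | no ne = trans (rowop-ne i j 0ℤ (Pr S Z0) a b (λ z → ne (sym z))) (Pr-zero S a b)

  module TriangularSystem {n : ℕ} (T : Fin n → Fin n → Set) (T? : ∀ a b → Dec (T a b))
    (ht : Fin n → Fin n → ℕ) (B : ℕ)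
    (T-right : ∀ {i j b} → T i j → ¬ T i b → ¬ T j b)
    (T-ne : ∀ {i j b} → T i j → ¬ T i b → j ≢ b)
    (ht-left : ∀ {i j b} → T i j → T j b → ht i j ℕ.< ht i b)
    (ht-right : ∀ {i j b} → T i j → T j b → ht j b ℕ.< ht i b)
    (T-irrefl : ∀ a → ¬ T a a)
    (ht-bound : ∀ {a b} → T a b → ht a b ℕ.< B) where

    AllT : List (Root n) → Set
    AllT S = All (λ r → T (proj₁ r) (proj₂ r)) S

    Pr-offT : ∀ S → AllT S → ∀ u a b → ¬ T a b → Pr S u a b ≡ δZ a b
    Pr-offT [] _ u a b _ = refl
    Pr-offT ((i , j) ∷ S) (tij ∷ al) u a b nt with i F.≟ a
    ... | no ne = trans (rowop-ne i j (u i j) (Pr S u) a b (λ z → ne (sym z))) (Pr-offT S al u a b nt)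
    ... | yes refl = trans (rowop-eq i j (u i j) (Pr S u) b)
          (trans (cong₂ (λ p q → p + u i j * q) (Pr-offT S al u i b nt)
                        (trans (Pr-offT S al u j b (T-right tij nt)) (δ-ne j b (T-ne tij nt))))
            (l₃ (δZ i b) (u i j)))

    Agree : ℤ → CZ n → CZ n → ℕ → Set
    Agree m u u' h = ∀ c d → T c d → ht c d ℕ.< h → Cg m (u c d) (u' c d)

    rest-local : ∀ S → AllT S → ∀ m a b → T a b → ∀ u u' → Agree m u u' (ht a b) →
      Cg m (rest S u a b) (rest S u' a b)
    rest-local [] _ m a b tab u u' ag = cg-≡ (trans (l₀ (δZ a b) (u a b)) (sym (l₀ (δZ a b) (u' a b))))
    rest-local ((i , j) ∷ S) (tij ∷ al) m a b tab u u' ag with toℕ i ℕ.≟ toℕ a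
    ... | no ne = cg-rewrite (rest-other-row i j S u a b ne') (rest-other-row i j S u' a b ne') (rest-local S al m a b tab u u' ag)
      where
      ne' : i ≢ a
      ne' z = ne (cong toℕ z)
    ... | yes e with FP.toℕ-injective e | toℕ j ℕ.≟ toℕ b
    ...   | refl | no nb = cg-rewrite (rest-same-row i j S u b nb') (rest-same-row i j S u' b nb')
                             (cg-+ (rest-local S al m i b tab u u' ag) summand)
      where
      nb' : j ≢ b
      nb' z = nb (cong toℕ z)
      -- the new term u_ij · (Pr S u) j b involves only coordinates of smaller height
      summand : Cg m (u i j * Pr S u j b) (u' i j * Pr S u' j b)
      summand with T? j b
      ... | no njb = cg-≡ (trans (vanishes u) (sym (vanishes u')))
        where
        vanishes : ∀ u → u i j * Pr S u j b ≡ 0ℤ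
        vanishes u = trans (cong (u i j *_) (trans (Pr-offT S al u j b njb) (δ-ne j b nb'))) (ℤP.*-zeroʳ (u i j))
      ... | yes tjb = cg-* (ag i j tij (ht-left tij tjb))
                           (cg-rewrite (l₄ (Pr S u j b) (+ cnt S j b) (u j b)) (l₄ (Pr S u' j b) (+ cnt S j b) (u' j b))
                             (cg-+ (rest-local S al m j b tjb u u' (λ c d tcd lt → ag c d tcd (NP.<-trans lt (ht-right tij tjb))))
                                   (cg-* (cg-refl {a = + cnt S j b}) (ag j b tjb (ht-right tij tjb)))))
    ...   | refl | yes e₂ with FP.toℕ-injective e₂
    ...   | refl = cg-rewrite (rest-root i j S u (diag u)) (rest-root i j S u' (diag u')) (rest-local S al m i j tab u u' ag)
      where
      diag : ∀ u → Pr S u j j ≡ 1ℤ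
      diag u = trans (Pr-offT S al u j j (T-irrefl j)) (δ-eq j)

    module Solve (S : List (Root n)) (al : AllT S) (once : ∀ a b → T a b → cnt S a b ≡ 1) where

      private
        r₁ : ∀ a x → a ≡ x - (x - a)
        r₁ = solve-∀
        r₂ : ∀ P u → P ≡ (P - u) + u
        r₂ = solve-∀
        r₃ : ∀ P₀ u₀ ℓ → (P₀ - u₀) + (u₀ + (ℓ - P₀)) ≡ ℓ
        r₃ = solve-∀
        r₄ : ∀ u a → u + (a - a) ≡ u
        r₄ = solve-∀

      Pr-local : ∀ m a b → T a b → ∀ u u' → Agree m u u' (ht a b) → Cg m (Pr S u a b - u a b) (Pr S u' a b - u' a b)
      Pr-local m a b t u u' ag = cg-rewrite (linear u) (linear u') (rest-local S al m a b t u u' ag)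
        where
        linear : ∀ u → Pr S u a b - u a b ≡ rest S u a b
        linear u = cong (λ c → Pr S u a b - c) (sym (trans (cong (λ c → + c * u a b) (once a b t)) (ℤP.*-identityˡ (u a b))))

      uniq : ∀ m u u' → (∀ a b → T a b → Cg m (Pr S u a b) (Pr S u' a b)) → ∀ a b → T a b → Cg m (u a b) (u' a b)
      uniq m u u' h a b t = byHeight B a b t (ht-bound t)
        where
        byHeight : ∀ H a b → T a b → ht a b ℕ.< H → Cg m (u a b) (u' a b)
        byHeight (suc H) a b t lt =
          cg-rewrite (r₁ (u a b) (Pr S u a b)) (r₁ (u' a b) (Pr S u a b)) (cg-+ (cg-refl {a = Pr S u a b}) (cg-neg step))
          where
          step : Cg m (Pr S u a b - u a b) (Pr S u a b - u' a b)
          step = cg-trans (Pr-local m a b t u u' (λ c d tcd l → byHeight H c d tcd (NP.≤-trans l (NP.≤-pred lt))))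
                          (cg-+ (cg-sym (h a b t)) (cg-refl {a = - u' a b}))

      iter : MZ n → ℕ → CZ n
      iter ℓ zero = Z0
      iter ℓ (suc s) a b = iter ℓ s a b + (ℓ a b - Pr S (iter ℓ s) a b)

      -- after s steps the equation holds at all T-positions of height < s
      exist : ∀ m ℓ → ∀ a b → T a b → Cg m (Pr S (iter ℓ B) a b) (ℓ a b)
      exist m ℓ a b t = solved B a b t (ht-bound t)
        where
        solved : ∀ s a b → T a b → ht a b ℕ.< s → Cg m (Pr S (iter ℓ s) a b) (ℓ a b)
        solved (suc s) a b t lt =
          cg-rewrite (r₂ (Pr S (iter ℓ (suc s)) a b) (iter ℓ (suc s) a b)) (sym (r₃ (Pr S (iter ℓ s) a b) (iter ℓ s a b) (ℓ a b)))
            (cg-+ (Pr-local m a b t (iter ℓ (suc s)) (iter ℓ s) stable) (cg-refl {a = iter ℓ (suc s) a b}))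
          where
          -- lower coordinates no longer change
          stable : Agree m (iter ℓ (suc s)) (iter ℓ s) (ht a b)
          stable c d tcd l =
            cg-trans (cg-+ (cg-refl {a = iter ℓ s c d})
                           (cg-+ (cg-sym (solved s c d tcd (NP.≤-trans l (NP.≤-pred lt)))) (cg-refl {a = - Pr S (iter ℓ s) c d})))
                     (cg-≡ (r₄ (iter ℓ s c d) (Pr S (iter ℓ s) c d)))

      modp : ∀ p ℓ → (∀ a b → T a b → Cg p (ℓ a b) 0ℤ) → ∀ s a b → T a b → Cg p (iter ℓ s a b) 0ℤ
      modp p ℓ hℓ zero a b t = cg-refl
      modp p ℓ hℓ (suc s) a b t = cg-+ ih (cg-+ (hℓ a b t) (cg-neg PrZero))
        where
        ih : Cg p (iter ℓ s a b) 0ℤ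
        ih = modp p ℓ hℓ s a b t
        PrZero : Cg p (Pr S (iter ℓ s) a b) 0ℤ
        PrZero = cg-rewrite (r₂ (Pr S (iter ℓ s) a b) (iter ℓ s a b)) (sym (trans (ℤP.+-identityʳ _) offDiag))
                   (cg-+ (Pr-local p a b t (iter ℓ s) Z0 (λ c d tcd _ → modp p ℓ hℓ s c d tcd)) ih)
          where
          offDiag : Pr S Z0 a b - 0ℤ ≡ 0ℤ
          offDiag = trans (ℤP.+-identityʳ _) (trans (Pr-zero S a b) (δ-ne a b (λ { refl → T-irrefl a t })))

open UnipotentProducts

-- The truncated geometric series  geom a k = Σ_{i<k} aⁱ  used by Defs for
-- (1+v)⁻¹ at level k: it satisfies (1 − a)·geom a k = 1 − aᵏ, so for p ∣ v
-- it inverts 1 + v modulo pᵏ, it is ≡ 1 mod p, and consecutive truncations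
-- differ by aᵏ (needed for compatibility of the levels).
module GeometricSeries where

  open import Data.Integer using (_+_; _*_; _-_)

  geom-id : ∀ a k → (1ℤ - a) * geom a k ≡ 1ℤ - a ℤ.^ k
  geom-id a zero = l a
    where
    l : ∀ a → (1ℤ - a) * 0ℤ ≡ 1ℤ - 1ℤ
    l = solve-∀
  geom-id a (suc k) = trans (l a (geom a k)) (trans (cong (λ z → (1ℤ - a) + a * z) (geom-id a k)) (l₂ a (a ℤ.^ k)))
    where
    l : ∀ a G → (1ℤ - a) * (1ℤ + a * G) ≡ (1ℤ - a) + a * ((1ℤ - a) * G)
    l = solve-∀
    l₂ : ∀ a y → (1ℤ - a) + a * (1ℤ - y) ≡ 1ℤ - a * y
    l₂ = solve-∀

  geom-step : ∀ a k → geom a (suc k) - geom a k ≡ a ℤ.^ k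
  geom-step a zero = l a
    where
    l : ∀ a → (1ℤ + a * 0ℤ) - 0ℤ ≡ 1ℤ
    l = solve-∀
  geom-step a (suc k) = trans (l a (geom a (suc k)) (geom a k)) (cong (a *_) (geom-step a k))
    where
    l : ∀ a G₁ G₀ → (1ℤ + a * G₁) - (1ℤ + a * G₀) ≡ a * (G₁ - G₀)
    l = solve-∀

  pow-dv : ∀ (p : ℕ) x k → Dv (+ p) x → Dv (+ (p ℕ.^ k)) (x ℤ.^ k)
  pow-dv p x zero _ = divides 1ℤ refl
  pow-dv p x (suc k) (divides q₁ e₁) with pow-dv p x k (divides q₁ e₁)
  ... | divides q₂ e₂ = divides (q₁ * q₂)
        (trans (cong₂ _*_ e₁ e₂) (trans (l q₁ (+ p) q₂ (+ (p ℕ.^ k))) (cong ((q₁ * q₂) *_) (sym (ℤP.pos-* p (p ℕ.^ k))))))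
    where
    l : ∀ a b c d → (a * b) * (c * d) ≡ (a * c) * (b * d)
    l = solve-∀

  geom-inverse : ∀ p k v → Dv (+ p) v → Cg (+ (p ℕ.^ k)) ((1ℤ + v) * geom (- v) k) 1ℤ
  geom-inverse p k v hv =
    cg (dv-≡ (sym (trans (cong (_- 1ℤ) (trans (cong (_* geom (- v) k) (l₁ v)) (geom-id (- v) k))) (l₂ ((- v) ℤ.^ k))))
             (dv-neg (pow-dv p (- v) k (dv-neg hv))))
    where
    l₁ : ∀ v → 1ℤ + v ≡ 1ℤ - (- v)
    l₁ = solve-∀
    l₂ : ∀ y → (1ℤ - y) - 1ℤ ≡ - y
    l₂ = solve-∀

  geom-unit : ∀ p k v → Dv (+ p) v → Cg (+ p) (geom (- v) (suc k)) 1ℤ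
  geom-unit p k v hv = cg (dv-≡ (sym (l v (geom (- v) k))) (dv-neg (dv-*r (geom (- v) k) hv)))
    where
    l : ∀ v G → (1ℤ + (- v) * G) - 1ℤ ≡ - (v * G)
    l = solve-∀

open GeometricSeries

module Cancellation (P m : ℤ) (inv : ℤ → ℤ) (invL : ∀ U → Cg P U 1ℤ → Cg m (U ℤ.* inv U) 1ℤ) where

  open import Data.Integer using (_*_)

  cancel : ∀ a b U → Cg P U 1ℤ → Cg m (a * U) (b * U) → Cg m a b
  cancel a b U hU h =
    cg-trans (cg-sym (unitFactor a)) (cg-trans (cg-≡ (r a U (inv U)))
      (cg-trans (cg-* h (cg-refl {a = inv U})) (cg-trans (cg-≡ (sym (r b U (inv U)))) (unitFactor b))))
    where
    r : ∀ a U I → a * (U * I) ≡ (a * U) * I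
    r = solve-∀
    unitFactor : ∀ a → Cg m (a * (U * inv U)) a
    unitFactor a = cg-trans (cg-* (cg-refl {a = a}) (invL U hU)) (cg-≡ (ℤP.*-identityʳ a))

module LDUFactorisation where

  open import Data.Integer using (_+_; _*_; _-_)

  LowU : ∀ {n} → MZ n → Set
  LowU ℓ = (∀ a → ℓ a a ≡ 1ℤ) × (∀ a b → toℕ a ℕ.< toℕ b → ℓ a b ≡ 0ℤ)

  UpU : ∀ {n} → MZ n → Set
  UpU μ = (∀ a → μ a a ≡ 1ℤ) × (∀ a b → toℕ b ℕ.< toℕ a → μ a b ≡ 0ℤ)

  ldu : ∀ {n} → MZ n → (Fin n → ℤ) → MZ n → MZ n
  ldu ℓ d μ a b = sumℤ (λ c → ℓ a c * d c * μ c b)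

  tail : ∀ {n} → MZ (suc n) → MZ n
  tail M a b = M (suc a) (suc b)

  tailV : ∀ {n} → (Fin (suc n) → ℤ) → Fin n → ℤ
  tailV d c = d (suc c)

  private
    sum-zero : ∀ {n} (f : Fin n → ℤ) → (∀ c → f c ≡ 0ℤ) → sumℤ f ≡ 0ℤ
    sum-zero {n} f h = trans (sum-ext h) (sum-0 {n})
    z₁ : ∀ x y → 0ℤ * x * y ≡ 0ℤ
    z₁ = solve-∀
    z₂ : ∀ x y → x * y * 0ℤ ≡ 0ℤ
    z₂ = solve-∀

  module Blocks {n} (ℓ : MZ (suc n)) (d : Fin (suc n) → ℤ) (μ : MZ (suc n)) (hℓ : LowU ℓ) (hμ : UpU μ) where

    row0 : ∀ b → sumℤ (λ c → ℓ zero (suc c) * d (suc c) * μ (suc c) b) ≡ 0ℤ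
    row0 b = sum-zero _ (λ c → trans (cong (λ z → z * d (suc c) * μ (suc c) b) (proj₂ hℓ zero (suc c) (s≤s z≤n))) (z₁ (d (suc c)) (μ (suc c) b)))

    col0 : ∀ a → sumℤ (λ c → ℓ a (suc c) * d (suc c) * μ (suc c) zero) ≡ 0ℤ
    col0 a = sum-zero _ (λ c → trans (cong (λ z → ℓ a (suc c) * d (suc c) * z) (proj₂ hμ (suc c) zero (s≤s z≤n))) (z₂ (ℓ a (suc c)) (d (suc c))))

    e00 : ldu ℓ d μ zero zero ≡ d zero
    e00 = trans (cong₂ _+_ (cong₂ (λ x y → x * d zero * y) (proj₁ hℓ zero) (proj₁ hμ zero)) (row0 zero)) (l (d zero))
      where
      l : ∀ x → 1ℤ * x * 1ℤ + 0ℤ ≡ x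
      l = solve-∀

    e0s : ∀ b → ldu ℓ d μ zero (suc b) ≡ d zero * μ zero (suc b)
    e0s b = trans (cong₂ _+_ (cong (λ x → x * d zero * μ zero (suc b)) (proj₁ hℓ zero)) (row0 (suc b))) (l (d zero) (μ zero (suc b)))
      where
      l : ∀ x y → 1ℤ * x * y + 0ℤ ≡ x * y
      l = solve-∀

    es0 : ∀ a → ldu ℓ d μ (suc a) zero ≡ ℓ (suc a) zero * d zero
    es0 a = trans (cong₂ _+_ (cong (λ y → ℓ (suc a) zero * d zero * y) (proj₁ hμ zero)) (col0 (suc a))) (l (ℓ (suc a) zero) (d zero))
      where
      l : ∀ x y → x * y * 1ℤ + 0ℤ ≡ x * y
      l = solve-∀

    lowTail : LowU (tail ℓ)
    lowTail = (λ a → proj₁ hℓ (suc a)) , (λ a b lt → proj₂ hℓ (suc a) (suc b) (s≤s lt))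

    upTail : UpU (tail μ)
    upTail = (λ a → proj₁ hμ (suc a)) , (λ a b lt → proj₂ hμ (suc a) (suc b) (s≤s lt))

  lowerBorder : ∀ {n} → (Fin n → ℤ) → MZ n → MZ (suc n)
  lowerBorder c ℓ zero zero = 1ℤ
  lowerBorder c ℓ zero (suc b) = 0ℤ
  lowerBorder c ℓ (suc a) zero = c a
  lowerBorder c ℓ (suc a) (suc b) = ℓ a b

  upperBorder : ∀ {n} → (Fin n → ℤ) → MZ n → MZ (suc n)
  upperBorder r μ zero zero = 1ℤ
  upperBorder r μ zero (suc b) = r b
  upperBorder r μ (suc a) zero = 0ℤ
  upperBorder r μ (suc a) (suc b) = μ a b

  lowerBorder-LowU : ∀ {n} (c : Fin n → ℤ) ℓ → LowU ℓ → LowU (lowerBorder c ℓ)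
  lowerBorder-LowU c ℓ hℓ = diag , upper
    where
    diag : ∀ a → lowerBorder c ℓ a a ≡ 1ℤ
    diag zero = refl
    diag (suc a) = proj₁ hℓ a
    upper : ∀ a b → toℕ a ℕ.< toℕ b → lowerBorder c ℓ a b ≡ 0ℤ
    upper zero (suc b) _ = refl
    upper (suc a) (suc b) (s≤s lt) = proj₂ hℓ a b lt

  upperBorder-UpU : ∀ {n} (r : Fin n → ℤ) μ → UpU μ → UpU (upperBorder r μ)
  upperBorder-UpU r μ hμ = diag , lower
    where
    diag : ∀ a → upperBorder r μ a a ≡ 1ℤ
    diag zero = refl
    diag (suc a) = proj₁ hμ a
    lower : ∀ a b → toℕ b ℕ.< toℕ a → upperBorder r μ a b ≡ 0ℤ
    lower (suc a) zero _ = refl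
    lower (suc a) (suc b) (s≤s lt) = proj₂ hμ a b lt

  LowU-agree : ∀ {m n} {A B : MZ n} → LowU A → LowU B →
    (∀ a c → toℕ c ℕ.< toℕ a → Cg m (A a c) (B a c)) → ∀ a c → Cg m (A a c) (B a c)
  LowU-agree {A = A} {B} hA hB below a c with NP.<-cmp (toℕ c) (toℕ a)
  ... | tri< lt _ _ = below a c lt
  ... | tri≈ _ e _ rewrite FP.toℕ-injective e = cg-≡ (trans (proj₁ hA a) (sym (proj₁ hB a)))
  ... | tri> _ _ gt = cg-≡ (trans (proj₂ hA a c gt) (sym (proj₂ hB a c gt)))

  UpU-agree : ∀ {m n} {A B : MZ n} → UpU A → UpU B →
    (∀ c b → toℕ c ℕ.< toℕ b → Cg m (A c b) (B c b)) → ∀ c b → Cg m (A c b) (B c b)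
  UpU-agree {A = A} {B} hA hB above c b with NP.<-cmp (toℕ c) (toℕ b)
  ... | tri< lt _ _ = above c b lt
  ... | tri≈ _ e _ rewrite FP.toℕ-injective e = cg-≡ (trans (proj₁ hA b) (sym (proj₁ hB b)))
  ... | tri> _ _ gt = cg-≡ (trans (proj₂ hA c b gt) (sym (proj₂ hB c b gt)))

  consV : ∀ {n} → ℤ → (Fin n → ℤ) → Fin (suc n) → ℤ
  consV x d zero = x
  consV x d (suc c) = d c

  -- bordering a factorisation of the Schur complement of g by the first
  -- column and row of g (divided by the pivot) gives a factorisation of g
  bordered-ldu : ∀ {m n} (g : MZ (suc n)) iA → Cg m (g zero zero * iA) 1ℤ →
    ∀ ℓ' d' μ' → LowU ℓ' → UpU μ' → (∀ a b → Cg m (ldu ℓ' d' μ' a b) (schurM g iA a b)) →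
    ∀ a b → Cg m (ldu (lowerBorder (λ a → g (suc a) zero * iA) ℓ') (consV (g zero zero) d')
                      (upperBorder (λ b → iA * g zero (suc b)) μ') a b) (g a b)
  bordered-ldu {m} g iA AiA ℓ' d' μ' hℓ' hμ' schur = prod
    where
    A = g zero zero
    ℓ = lowerBorder (λ a → g (suc a) zero * iA) ℓ'
    d = consV A d'
    μ = upperBorder (λ b → iA * g zero (suc b)) μ'
    module E = Blocks ℓ d μ (lowerBorder-LowU _ ℓ' hℓ') (upperBorder-UpU _ μ' hμ')
    k₁ : ∀ A i x → A * (i * x) ≡ (A * i) * x
    k₁ = solve-∀
    k₂ : ∀ y i A → y * i * A ≡ y * (A * i)
    k₂ = solve-∀
    k₃ : ∀ y i A x → y * i * A * (i * x) ≡ (y * i * x) * (A * i)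
    k₃ = solve-∀
    k₄ : ∀ X G → X + (G - X) ≡ G
    k₄ = solve-∀
    prod : ∀ a b → Cg m (ldu ℓ d μ a b) (g a b)
    prod zero zero = cg-≡ E.e00
    prod zero (suc b) = cg-rewrite (trans (E.e0s b) (k₁ A iA (g zero (suc b)))) (sym (ℤP.*-identityˡ _))
                                   (cg-* AiA (cg-refl {a = g zero (suc b)}))
    prod (suc a) zero = cg-rewrite (trans (E.es0 a) (k₂ (g (suc a) zero) iA A)) (sym (ℤP.*-identityʳ _))
                                   (cg-* (cg-refl {a = g (suc a) zero}) AiA)
    prod (suc a) (suc b) = cg-trans (cg-+ border (schur a b)) (cg-≡ (k₄ X (g (suc a) (suc b))))
      where
      X = g (suc a) zero * iA * g zero (suc b)
      border : Cg m (ℓ (suc a) zero * d zero * μ zero (suc b)) X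
      border = cg-rewrite (k₃ (g (suc a) zero) iA A (g zero (suc b))) (sym (ℤP.*-identityʳ X)) (cg-* (cg-refl {a = X}) AiA)

  module LDU (P m : ℤ) (inv : ℤ → ℤ) (invL : ∀ U → Cg P U 1ℤ → Cg m (U * inv U) 1ℤ) where

    open Cancellation P m inv invL

    Good : ∀ {n} → MZ n → Set
    Good g = (∀ a b → toℕ b ℕ.< toℕ a → Dv P (g a b)) × (∀ a → Cg P (g a a) 1ℤ)

    -- uniqueness: the first row and column of ℓ d μ determine d₀, μ's first
    -- row and ℓ's first column (cancelling the unit d₀); subtracting their
    -- product leaves tail ℓ · tail d · tail μ, to which induction applies
    uniq : ∀ {n} (ℓ : MZ n) d μ ℓ₂ d₂ μ₂ → LowU ℓ → UpU μ → LowU ℓ₂ → UpU μ₂ → (∀ c → Cg P (d c) 1ℤ) →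
       (∀ a b → Cg m (ldu ℓ d μ a b) (ldu ℓ₂ d₂ μ₂ a b)) →
       (∀ a b → Cg m (ℓ a b) (ℓ₂ a b)) × (∀ c → Cg m (d c) (d₂ c)) × (∀ a b → Cg m (μ a b) (μ₂ a b))
    uniq {zero} ℓ d μ ℓ₂ d₂ μ₂ _ _ _ _ _ _ = (λ ()) , (λ ()) , (λ ())
    uniq {suc n} ℓ d μ ℓ₂ d₂ μ₂ hℓ hμ hℓ₂ hμ₂ hd h = sameℓ , samed , sameμ
      where
      module B₁ = Blocks ℓ d μ hℓ hμ
      module B₂ = Blocks ℓ₂ d₂ μ₂ hℓ₂ hμ₂
      pivot : Cg m (d zero) (d₂ zero)
      pivot = cg-rewrite (sym B₁.e00) (sym B₂.e00) (h zero zero)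
      firstRow : ∀ b → Cg m (μ zero (suc b)) (μ₂ zero (suc b))
      firstRow b = cancel (μ zero (suc b)) (μ₂ zero (suc b)) (d zero) (hd zero)
        (cg-rewrite (trans (ℤP.*-comm (μ zero (suc b)) (d zero)) (sym (B₁.e0s b))) refl
          (cg-trans (h zero (suc b)) (cg-trans (cg-≡ (B₂.e0s b))
            (cg-trans (cg-* (cg-sym pivot) (cg-refl {a = μ₂ zero (suc b)})) (cg-≡ (ℤP.*-comm (d zero) (μ₂ zero (suc b))))))))
      firstCol : ∀ a → Cg m (ℓ (suc a) zero) (ℓ₂ (suc a) zero)
      firstCol a = cancel (ℓ (suc a) zero) (ℓ₂ (suc a) zero) (d zero) (hd zero)
        (cg-rewrite (sym (B₁.es0 a)) refl
          (cg-trans (h (suc a) zero) (cg-trans (cg-≡ (B₂.es0 a)) (cg-* (cg-refl {a = ℓ₂ (suc a) zero}) (cg-sym pivot)))))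
      l : ∀ x y → - x + (x + y) ≡ y
      l = solve-∀
      tails : ∀ a b → Cg m (ldu (tail ℓ) (tailV d) (tail μ) a b) (ldu (tail ℓ₂) (tailV d₂) (tail μ₂) a b)
      tails a b = cg-rewrite (sym (l (ℓ (suc a) zero * d zero * μ zero (suc b)) _)) (sym (l (ℓ₂ (suc a) zero * d₂ zero * μ₂ zero (suc b)) _))
        (cg-+ (cg-neg (cg-* (cg-* (firstCol a) pivot) (firstRow b))) (h (suc a) (suc b)))
      ih = uniq (tail ℓ) (tailV d) (tail μ) (tail ℓ₂) (tailV d₂) (tail μ₂)
                B₁.lowTail B₁.upTail B₂.lowTail B₂.upTail (λ c → hd (suc c)) tails
      sameℓ : ∀ a b → Cg m (ℓ a b) (ℓ₂ a b)
      sameℓ zero zero = cg-≡ (trans (proj₁ hℓ zero) (sym (proj₁ hℓ₂ zero)))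
      sameℓ zero (suc b) = cg-≡ (trans (proj₂ hℓ zero (suc b) (s≤s z≤n)) (sym (proj₂ hℓ₂ zero (suc b) (s≤s z≤n))))
      sameℓ (suc a) zero = firstCol a
      sameℓ (suc a) (suc b) = proj₁ ih a b
      samed : ∀ c → Cg m (d c) (d₂ c)
      samed zero = pivot
      samed (suc c) = proj₁ (proj₂ ih) c
      sameμ : ∀ a b → Cg m (μ a b) (μ₂ a b)
      sameμ zero zero = cg-≡ (trans (proj₁ hμ zero) (sym (proj₁ hμ₂ zero)))
      sameμ zero (suc b) = firstRow b
      sameμ (suc a) zero = cg-≡ (trans (proj₂ hμ (suc a) zero (s≤s z≤n)) (sym (proj₂ hμ₂ (suc a) zero (s≤s z≤n))))
      sameμ (suc a) (suc b) = proj₂ (proj₂ ih) a b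

    record Factorisation {n} (g : MZ n) : Set where
      field
        ℓ : MZ n
        d : Fin n → ℤ
        μ : MZ n
        hℓ : LowU ℓ
        hℓP : ∀ a b → toℕ b ℕ.< toℕ a → Dv P (ℓ a b)
        hd : ∀ c → Cg P (d c) 1ℤ
        hμ : UpU μ
        prod : ∀ a b → Cg m (ldu ℓ d μ a b) (g a b)
        hdet : Cg m (detℤ g) (prodF d)

    -- existence: eliminate the first row and column with the pivot g₀₀ and
    -- factor the Schur complement, which is again upper unipotent mod P
    exist : ∀ {n} (g : MZ n) → Good g → Factorisation g
    exist {zero} g _ = record { ℓ = λ () ; d = λ () ; μ = λ () ; hℓ = (λ ()) , (λ ()) ; hℓP = λ ()
                              ; hd = λ () ; hμ = (λ ()) , (λ ()) ; prod = λ () ; hdet = cg-refl }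
    exist {suc n} g (gl , gd) = record
      { ℓ = ℓ ; d = d ; μ = μ ; hℓ = hℓ ; hℓP = hℓP ; hd = hd ; hμ = hμ
      ; prod = bordered-ldu g iA AiA R.ℓ R.d R.μ R.hℓ R.hμ R.prod
      ; hdet = cg-trans (det-schur g iA AiA) (cg-* (cg-refl {a = A}) R.hdet) }
      where
      A = g zero zero
      iA = inv A
      AiA : Cg m (A * iA) 1ℤ
      AiA = invL A (gd zero)
      lowP : ∀ a → Dv P (g (suc a) zero * iA)
      lowP a = dv-*r iA (gl (suc a) zero (s≤s z≤n))
      schurGood : Good (schurM g iA)
      schurGood = (λ a b lt → dv-+ (gl (suc a) (suc b) (s≤s lt)) (dv-neg (dv-*r (g zero (suc b)) (lowP a))))
                , (λ a → cg-trans (cg-+ (gd (suc a)) (cg-neg (dv→cg0 (dv-*r (g zero (suc a)) (lowP a))))) (cg-≡ refl))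
      module R = Factorisation (exist (schurM g iA) schurGood)
      ℓ : MZ (suc n)
      ℓ = lowerBorder (λ a → g (suc a) zero * iA) R.ℓ
      d : Fin (suc n) → ℤ
      d = consV A R.d
      μ : MZ (suc n)
      μ = upperBorder (λ b → iA * g zero (suc b)) R.μ
      hℓ : LowU ℓ
      hℓ = lowerBorder-LowU _ R.ℓ R.hℓ
      hμ : UpU μ
      hμ = upperBorder-UpU _ R.μ R.hμ
      hℓP : ∀ a b → toℕ b ℕ.< toℕ a → Dv P (ℓ a b)
      hℓP (suc a) zero _ = lowP a
      hℓP (suc a) (suc b) (s≤s lt) = R.hℓP a b lt
      hd : ∀ c → Cg P (d c) 1ℤ
      hd zero = gd zero
      hd (suc c) = R.hd c

open LDUFactorisation

-- The modulus of level k = k' + 1: m = pᵏ, with P = p.  Elements ≡ 1 mod p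
-- are inverted mod m by the truncated geometric series.
module Modulus (p k' : ℕ) where

  open import Data.Integer using (_+_; _*_; _-_)

  k : ℕ
  k = suc k'

  P m : ℤ
  P = + p
  m = + (p ℕ.^ k)

  invU : ℤ → ℤ
  invU U = geom (- (U - 1ℤ)) k

  invL : ∀ U → Cg P U 1ℤ → Cg m (U * invU U) 1ℤ
  invL U h = cg-trans (cg-≡ (cong (_* invU U) (sym (r U)))) (geom-inverse p k (U - 1ℤ) (unCg h))
    where
    r : ∀ U → 1ℤ + (U - 1ℤ) ≡ U
    r = solve-∀

  open Cancellation P m invU invL public

-- H(v) is diagonal; its prefix products
-- d₀⋯dᵢ are ≡ 1 + v_{(i,i+1)} for i < n−1 and ≡ 1 for i = n−1, since
-- h_{(i,i+1)}(1+v) contributes 1+v at i and (1+v)⁻¹ at i+1.  A vector d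
-- with entries ≡ 1 mod p is determined by its prefix products, so
-- H(v) ≡ diag d is solvable (uniquely) iff ∏ d ≡ 1.
module Torus (p k' : ℕ) where

  open import Data.Integer using (_+_; _*_; _-_)
  open Modulus p k'

  prodL : ∀ {A : Set} → (A → ℤ) → List A → ℤ
  prodL h [] = 1ℤ
  prodL h (x ∷ xs) = h x * prodL h xs

  prodL-cg : ∀ {A : Set} {m} {f g : A → ℤ} (S : List A) → All (λ r → Cg m (f r) (g r)) S → Cg m (prodL f S) (prodL g S)
  prodL-cg [] _ = cg-refl
  prodL-cg (r ∷ S) (h ∷ hs) = cg-* h (prodL-cg S hs)

  prodL-1 : ∀ {A : Set} {f : A → ℤ} (S : List A) → All (λ r → f r ≡ 1ℤ) S → prodL f S ≡ 1ℤ
  prodL-1 [] _ = refl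
  prodL-1 (r ∷ S) (h ∷ hs) = cong₂ _*_ h (prodL-1 S hs)

  prodL-const1 : ∀ {A : Set} (S : List A) → prodL (λ _ → 1ℤ) S ≡ 1ℤ
  prodL-const1 [] = refl
  prodL-const1 (r ∷ S) = trans (ℤP.*-identityˡ _) (prodL-const1 S)

  prodL-if : ∀ {A : Set} (b : Bool) (f : A → ℤ) S → (if b then prodL f S else 1ℤ) ≡ prodL (λ r → if b then f r else 1ℤ) S
  prodL-if true f S = refl
  prodL-if false f S = sym (prodL-const1 S)

  prod-swap : ∀ {A : Set} {n} (g : A → Fin n → ℤ) (S : List A) → prodF (λ c → prodL (λ r → g r c) S) ≡ prodL (λ r → prodF (g r)) S
  prod-swap {n = n} g [] = prod-1 {n}
  prod-swap g (r ∷ S) = trans (prod-* (g r) (λ c → prodL (λ r → g r c) S)) (cong (prodF (g r) *_) (prod-swap g S))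

  prodL-pow : ∀ {n} (f : Root n → ℤ) (S : List (Root n)) (a b : Fin n) →
    All (λ r → (proj₁ r ≢ a ⊎ proj₂ r ≢ b) → f r ≡ 1ℤ) S → prodL f S ≡ f (a , b) ℤ.^ cnt S a b
  prodL-pow f [] a b _ = refl
  prodL-pow f ((i , j) ∷ S) a b (h ∷ hs) with toℕ i ℕ.≟ toℕ a | toℕ j ℕ.≟ toℕ b
  ... | no ne | _ = trans (cong₂ _*_ (h (inj₁ (λ z → ne (cong toℕ z)))) (prodL-pow f S a b hs))
                     (trans (ℤP.*-identityˡ _) (cong (f (a , b) ℤ.^_) (sym (cnt-ne1 i j S a b (λ z → ne (cong toℕ z))))))
  ... | yes _ | no ne = trans (cong₂ _*_ (h (inj₂ (λ z → ne (cong toℕ z)))) (prodL-pow f S a b hs))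
                     (trans (ℤP.*-identityˡ _) (cong (f (a , b) ℤ.^_) (sym (cnt-ne2 i j S a b (λ z → ne (cong toℕ z))))))
  ... | yes e1 | yes e2 with FP.toℕ-injective e1 | FP.toℕ-injective e2
  ... | refl | refl = trans (cong (f (i , j) *_) (prodL-pow f S i j hs)) (cong (f (i , j) ℤ.^_) (sym (cong (ℕ._+ cnt S i j) (ind-eq i j))))

  if1cg : ∀ {m} (b : Bool) {x : ℤ} → Cg m x 1ℤ → Cg m (if b then x else 1ℤ) 1ℤ
  if1cg true h = h
  if1cg false h = cg-refl

  if11 : ∀ (b : Bool) {x : ℤ} → x ≡ 1ℤ → (if b then x else 1ℤ) ≡ 1ℤ
  if11 true e = e
  if11 false e = refl

  module Diag {n : ℕ} {A : Set} (D : A → MZ n) (hD : ∀ r a b → a ≢ b → D r a b ≡ 0ℤ) where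
    off : ∀ S a b → a ≢ b → prodZ (map D S) a b ≡ 0ℤ
    off [] a b ne = δ-ne a b ne
    off (r ∷ S) a b ne = trans (mul-diag (D r) (prodZ (map D S)) (hD r) a b) (trans (cong (D r a a *_) (off S a b ne)) (ℤP.*-zeroʳ (D r a a)))
    on : ∀ S a → prodZ (map D S) a a ≡ prodL (λ r → D r a a) S
    on [] a = δ-eq a
    on (r ∷ S) a = trans (mul-diag (D r) (prodZ (map D S)) (hD r) a a) (cong (D r a a *_) (on S a))

  le : ∀ {n} → Fin n → Fin n → Bool
  le c i = ⌊ toℕ c ℕ.≤? toℕ i ⌋

  PF : ∀ {n} → (Fin n → ℤ) → Fin n → ℤ
  PF f i = prodF (λ c → if le c i then f c else 1ℤ)

  PF-cg : ∀ {n} {f g : Fin n → ℤ} {M} → (∀ c → Cg M (f c) (g c)) → ∀ i → Cg M (PF f i) (PF g i)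
  PF-cg h i = prod-cg (λ c → cg-if (le c i) (h c) cg-refl)

  PF-unit : ∀ {n} (f : Fin n → ℤ) → (∀ c → Cg P (f c) 1ℤ) → ∀ i → Cg P (PF f i) 1ℤ
  PF-unit f h i = prod-cg1 _ (λ c → if1cg (le c i) (h c))

  PF-zero : ∀ {n} (f : Fin (suc n) → ℤ) → PF f zero ≡ f zero
  PF-zero {n} f = trans (cong (f zero *_) (prod-1 {n})) (ℤP.*-identityʳ _)

  PF-suc : ∀ {n} (f : Fin (suc (suc n)) → ℤ) (c0 : Fin (suc n)) → PF f (suc c0) ≡ f (suc c0) * PF f (F.inject₁ c0)
  PF-suc f c0 = trans (prod-pick _ _ (suc c0) gc ge) (cong (_* PF f (F.inject₁ c0)) lec)
    where
    lec : (if le (suc c0) (suc c0) then f (suc c0) else 1ℤ) ≡ f (suc c0)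
    lec rewrite isYes-t (toℕ (suc c0) ℕ.≤? toℕ (suc c0)) NP.≤-refl = refl
    tc : toℕ (F.inject₁ c0) ≡ toℕ c0
    tc = FP.toℕ-inject₁ c0
    gc : (if le (suc c0) (F.inject₁ c0) then f (suc c0) else 1ℤ) ≡ 1ℤ
    gc rewrite isYes-f (toℕ (suc c0) ℕ.≤? toℕ (F.inject₁ c0)) (λ z → NP.<-irrefl refl (NP.≤-trans z (NP.≤-reflexive tc))) = refl
    ge : ∀ e → e ≢ suc c0 → (if le e (F.inject₁ c0) then f e else 1ℤ) ≡ (if le e (suc c0) then f e else 1ℤ)
    ge e ne with toℕ e ℕ.≤? toℕ (F.inject₁ c0) | toℕ e ℕ.≤? toℕ (suc c0)
    ... | yes _ | yes _ = refl
    ... | no _ | no _ = refl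
    ... | yes l1 | no l2 = ⊥-elim (l2 (NP.m≤n⇒m≤1+n (NP.≤-trans l1 (NP.≤-reflexive tc))))
    ... | no l1 | yes l2 = ⊥-elim (ne (FP.toℕ-injective (NP.≤-antisym l2 (subst (λ z → suc z ℕ.≤ toℕ e) tc (NP.≰⇒> l1)))))

  prefix-determines : ∀ {n} (x y : Fin n → ℤ) → (∀ c → Cg P (x c) 1ℤ) → (∀ i → Cg m (PF x i) (PF y i)) → ∀ c → Cg m (x c) (y c)
  prefix-determines {suc n} x y hx h zero = cg-trans (cg-≡ (sym (PF-zero x))) (cg-trans (h zero) (cg-≡ (PF-zero y)))
  prefix-determines {suc (suc n)} x y hx h (suc c0) =
    cancel (x (suc c0)) (y (suc c0)) (PF x c') (PF-unit x hx c')
      (cg-trans (cg-≡ (sym (PF-suc x c0))) (cg-trans (h (suc c0)) (cg-trans (cg-≡ (PF-suc y c0)) (cg-* (cg-refl {a = y (suc c0)}) (cg-sym (h c'))))))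
    where
    c' = F.inject₁ c0

  module HFactor {n : ℕ} where

    S : List (Root n)
    S = simpleRoots n

    hD : CZ n → Root n → MZ n
    hD v r = hZ k (proj₁ r) (proj₂ r) (v (proj₁ r) (proj₂ r))
    hD-offdiag : ∀ v r a b → a ≢ b → hD v r a b ≡ 0ℤ
    hD-offdiag v r a b ne rewrite isYes-f (a F.≟ b) ne = refl

    Hd : CZ n → Fin n → ℤ
    Hd v c = HZ k v c c
    H-off : ∀ v a b → a ≢ b → HZ k v a b ≡ 0ℤ
    H-off v = Diag.off (hD v) (hD-offdiag v) S
    H-on : ∀ v c → Hd v c ≡ prodL (λ r → hD v r c c) S
    H-on v c = Diag.on (hD v) (hD-offdiag v) S c
    hd-i : ∀ v (i j : Fin n) → hD v (i , j) i i ≡ 1ℤ + v i j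
    hd-i v i j rewrite isYes-t (i F.≟ i) refl = refl
    hd-j : ∀ v (i j : Fin n) → i ≢ j → hD v (i , j) j j ≡ geom (- v i j) k
    hd-j v i j ne rewrite isYes-t (j F.≟ j) refl | isYes-f (j F.≟ i) (λ z → ne (sym z)) = refl
    hd-o : ∀ v (i j c : Fin n) → c ≢ i → c ≢ j → hD v (i , j) c c ≡ 1ℤ
    hd-o v i j c n1 n2 rewrite isYes-t (c F.≟ c) refl | isYes-f (c F.≟ i) n1 | isYes-f (c F.≟ j) n2 = refl

    ValidV : CZ n → Set
    ValidV v = ∀ i j → Simple i j → Dv P (v i j)

    simple-≢ : ∀ {i j : Fin n} → Simple i j → i ≢ j
    simple-≢ e refl = NP.<-irrefl e (NP.n<1+n _)

    H-unit : ∀ v → ValidV v → ∀ c → Cg P (Hd v c) 1ℤ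
    H-unit v hv c = cg-trans (cg-≡ (H-on v c)) (cg-trans (prodL-cg S (All.map f1 (simple-all n))) (cg-≡ (prodL-const1 S)))
      where
      f1 : ∀ {r} → Simple (proj₁ r) (proj₂ r) → Cg P (hD v r c c) 1ℤ
      f1 {i , j} e with toℕ c ℕ.≟ toℕ i | toℕ c ℕ.≟ toℕ j
      ... | yes e1 | _ with FP.toℕ-injective e1
      ... | refl = cg-trans (cg-≡ (hd-i v c j)) (cg-trans (cg-+ (cg-refl {a = 1ℤ}) (dv→cg0 (hv c j e))) (cg-≡ (ℤP.+-identityʳ 1ℤ)))
      f1 {i , j} e | no _ | yes e2 with FP.toℕ-injective e2
      ... | refl = cg-trans (cg-≡ (hd-j v i c (simple-≢ e))) (geom-unit p k' (v i c) (hv i c e))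
      f1 {i , j} e | no n1 | no n2 = cg-≡ (hd-o v i j c (λ z → n1 (cong toℕ z)) (λ z → n2 (cong toℕ z)))

    -- the contribution  [i' = i] (1 + v_{i'j'})  of the factor at (i' , j') to PF (Hd v) i
    rowFactor : CZ n → Fin n → Root n → ℤ
    rowFactor v i r = if ⌊ toℕ (proj₁ r) ℕ.≟ toℕ i ⌋ then 1ℤ + v (proj₁ r) (proj₂ r) else 1ℤ

    prefix-factor : ∀ v → ValidV v → ∀ i' j' → Simple i' j' → ∀ i → Cg m (prodF (λ c → if le c i then hD v (i' , j') c c else 1ℤ)) (rowFactor v i (i' , j'))
    prefix-factor v hv i' j' e i =
      cg-trans (cg-≡ (prod-two _ i' j' (simple-≢ e) (λ c n1 n2 → if11 (le c i) (hd-o v i' j' c n1 n2))))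
        (cg-trans (cg-≡ (cong₂ (λ a b → (if le i' i then a else 1ℤ) * (if le j' i then b else 1ℤ)) (hd-i v i' j') (hd-j v i' j' (simple-≢ e)))) cases)
      where
      V = v i' j'
      cases : Cg m ((if le i' i then 1ℤ + V else 1ℤ) * (if le j' i then geom (- V) k else 1ℤ)) (rowFactor v i (i' , j'))
      cases with NP.<-cmp (toℕ i') (toℕ i)
      ... | tri< lt _ _ rewrite isYes-t (toℕ i' ℕ.≤? toℕ i) (NP.<⇒≤ lt) | isYes-t (toℕ j' ℕ.≤? toℕ i) (subst (ℕ._≤ toℕ i) (sym e) lt)
                              | isYes-f (toℕ i' ℕ.≟ toℕ i) (λ z → NP.<-irrefl z lt) = geom-inverse p k V (hv i' j' e)
      ... | tri≈ _ eq _ rewrite isYes-t (toℕ i' ℕ.≤? toℕ i) (NP.≤-reflexive eq) | isYes-f (toℕ j' ℕ.≤? toℕ i) (λ z → NP.<-irrefl refl (NP.≤-trans (subst (λ w → suc w ℕ.≤ toℕ i) eq (subst (ℕ._≤ toℕ i) e z)) NP.≤-refl))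
                              | isYes-t (toℕ i' ℕ.≟ toℕ i) eq = cg-≡ (ℤP.*-identityʳ _)
      ... | tri> _ _ gt rewrite isYes-f (toℕ i' ℕ.≤? toℕ i) (NP.<⇒≱ gt) | isYes-f (toℕ j' ℕ.≤? toℕ i) (λ z → NP.<⇒≱ gt (NP.≤-trans (NP.n≤1+n _) (subst (ℕ._≤ toℕ i) e z)))
                              | isYes-f (toℕ i' ℕ.≟ toℕ i) (λ z → NP.<-irrefl (sym z) gt) = cg-refl

    PF-H : ∀ v → ValidV v → ∀ i → Cg m (PF (Hd v) i) (prodL (rowFactor v i) S)
    PF-H v hv i =
      cg-trans (cg-≡ (prod-ext (λ c → trans (cong (λ z → if le c i then z else 1ℤ) (H-on v c)) (prodL-if (le c i) (λ r → hD v r c c) S))))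
       (cg-trans (cg-≡ (prod-swap (λ r c → if le c i then hD v r c c else 1ℤ) S))
         (prodL-cg S (All.map (λ {r} e → prefix-factor v hv (proj₁ r) (proj₂ r) e i) (simple-all n))))

    PF-simple : ∀ v → ValidV v → ∀ i j → Simple i j → Cg m (PF (Hd v) i) (1ℤ + v i j)
    PF-simple v hv i j e = cg-trans (PF-H v hv i)
       (cg-≡ (trans (prodL-pow (rowFactor v i) S i j (All.map (λ {r} e' → one r e') (simple-all n)))
         (trans (cong (rowFactor v i (i , j) ℤ.^_) (cnt-simple n i j e)) (trans (ℤP.*-identityʳ _) tii))))
      where
      tii : rowFactor v i (i , j) ≡ 1ℤ + v i j
      tii rewrite isYes-t (toℕ i ℕ.≟ toℕ i) refl = refl
      one : ∀ r → Simple (proj₁ r) (proj₂ r) → (proj₁ r ≢ i ⊎ proj₂ r ≢ j) → rowFactor v i r ≡ 1ℤ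
      one (i' , j') e' h with toℕ i' ℕ.≟ toℕ i
      ... | no ne = refl
      ... | yes eq with h
      ...   | inj₁ n1 = ⊥-elim (n1 (FP.toℕ-injective eq))
      ...   | inj₂ n2 = ⊥-elim (n2 (FP.toℕ-injective (trans e' (trans (cong suc eq) (sym e)))))

    PF-last : ∀ v → ValidV v → ∀ i → suc (toℕ i) ≡ n → Cg m (PF (Hd v) i) 1ℤ
    PF-last v hv i el = cg-trans (PF-H v hv i) (cg-≡ (prodL-1 S (All.map (λ {r} e → one r e) (simple-all n))))
      where
      one : ∀ r → Simple (proj₁ r) (proj₂ r) → rowFactor v i r ≡ 1ℤ
      one (i' , j') e rewrite isYes-f (toℕ i' ℕ.≟ toℕ i) (λ z → NP.<-irrefl refl (NP.≤-trans (subst (λ w → suc (suc w) ℕ.≤ n) z (subst (ℕ._< n) e (FP.toℕ<n j'))) (NP.≤-reflexive (sym el)))) = refl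

    H-uniq : ∀ v v' → ValidV v → ValidV v' → (∀ c → Cg m (Hd v c) (Hd v' c)) → ∀ i j → Simple i j → Cg m (v i j) (v' i j)
    H-uniq v v' hv hv' h i j e = cg-trans (cg-≡ (sym (l (v i j)))) (cg-trans (cg-+ (cg-refl {a = - 1ℤ}) s1) (cg-≡ (l (v' i j))))
      where
      l : ∀ x → - 1ℤ + (1ℤ + x) ≡ x
      l = solve-∀
      s1 : Cg m (1ℤ + v i j) (1ℤ + v' i j)
      s1 = cg-trans (cg-sym (PF-simple v hv i j e)) (cg-trans (PF-cg h i) (PF-simple v' hv' i j e))

    H-exist : ∀ (d : Fin n → ℤ) → (∀ c → Cg P (d c) 1ℤ) → Cg m (prodF d) 1ℤ →
              Σ (CZ n) λ v → ValidV v × (∀ c → Cg m (Hd v c) (d c))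
    H-exist d hd hdet = v , hv , prefix-determines (Hd v) d (H-unit v hv) pf
      where
      v : CZ n
      v i j = PF d i - 1ℤ
      r : ∀ x → 1ℤ + (x - 1ℤ) ≡ x
      r = solve-∀
      hv : ValidV v
      hv i j e = unCg (PF-unit d hd i)
      pf : ∀ i → Cg m (PF (Hd v) i) (PF d i)
      pf i with suc (toℕ i) ℕ.<? n
      ... | yes lt = cg-trans (PF-simple v hv i j (FP.toℕ-fromℕ< lt)) (cg-≡ (r (PF d i)))
        where j = F.fromℕ< lt
      ... | no nlt = cg-trans (PF-last v hv i el) (cg-trans (cg-sym hdet) (cg-≡ (prod-ext (λ c → sym (allle c)))))
        where
        el : suc (toℕ i) ≡ n
        el = NP.≤-antisym (FP.toℕ<n i) (NP.≮⇒≥ nlt)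
        allle : ∀ c → (if le c i then d c else 1ℤ) ≡ d c
        allle c rewrite isYes-t (toℕ c ℕ.≤? toℕ i) (NP.≤-pred (subst (toℕ c ℕ.<_) (sym el) (FP.toℕ<n c))) = refl



module Level (p k' : ℕ) where

  open import Data.Integer using (_+_; _*_; _-_)
  open Modulus p k' public
  open Torus p k' public

  module LD = LDU P m invU invL

  module Low (n : ℕ) = TriangularSystem {n} (λ a b → toℕ b ℕ.< toℕ a) (λ a b → toℕ b ℕ.<? toℕ a) (λ a b → toℕ a ℕ.∸ toℕ b) n
    (λ {i} {j} {b} ji nib bj → nib (NP.<-trans bj ji))
    (λ {i} {j} {b} ji nib e → nib (subst (ℕ._< toℕ i) (cong toℕ e) ji))
    (λ {i} {j} {b} ji bj → NP.∸-monoʳ-< bj (NP.<⇒≤ ji))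
    (λ {i} {j} {b} ji bj → NP.∸-monoˡ-< ji (NP.<⇒≤ bj))
    (λ a → NP.<-irrefl refl)
    (λ {a} {b} _ → NP.≤-<-trans (NP.m∸n≤m (toℕ a) (toℕ b)) (FP.toℕ<n a))

  module Up (n : ℕ) = TriangularSystem {n} (λ a b → toℕ a ℕ.< toℕ b) (λ a b → toℕ a ℕ.<? toℕ b) (λ a b → toℕ b ℕ.∸ toℕ a) n
    (λ {i} {j} {b} ij nib jb → nib (NP.<-trans ij jb))
    (λ {i} {j} {b} ij nib e → nib (subst (toℕ i ℕ.<_) (cong toℕ e) ij))
    (λ {i} {j} {b} ij jb → NP.∸-monoˡ-< jb (NP.<⇒≤ ij))
    (λ {i} {j} {b} ij jb → NP.∸-monoʳ-< ij (NP.<⇒≤ jb))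
    (λ a → NP.<-irrefl refl)
    (λ {a} {b} _ → NP.≤-<-trans (NP.m∸n≤m (toℕ b) (toℕ a)) (FP.toℕ<n b))

  module NegSolve (n : ℕ) = Low.Solve n (negRoots n) (neg-all n) (cnt-neg n)
  module PosSolve (n : ℕ) = Up.Solve n (posRoots n) (pos-all n) (cnt-pos n)

  ValidL : ∀ {n} → CZ n → Set
  ValidL u = ∀ a b → Neg a b → Dv P (u a b)

  L-unitri : ∀ {n} (u : CZ n) → LowU (LZ u)
  L-unitri {n} u = (λ a → trans (Low.Pr-offT n (negRoots n) (neg-all n) u a a (NP.<-irrefl refl)) (δ-eq a))
             , (λ a b lt → trans (Low.Pr-offT n (negRoots n) (neg-all n) u a b (NP.<⇒≯ lt)) (δ-ne a b (λ e → NP.<-irrefl (cong toℕ e) lt)))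

  U-unitri : ∀ {n} (w : CZ n) → UpU (UZ w)
  U-unitri {n} w = (λ a → trans (Up.Pr-offT n (posRoots n) (pos-all n) w a a (NP.<-irrefl refl)) (δ-eq a))
             , (λ a b lt → trans (Up.Pr-offT n (posRoots n) (pos-all n) w a b (NP.<⇒≯ lt)) (δ-ne a b (λ e → NP.<-irrefl (cong toℕ (sym e)) lt)))

  dec-ldu : ∀ {n} (u v w : CZ n) a b → decZ k u v w a b ≡ ldu (LZ u) (HFactor.Hd v) (UZ w) a b
  dec-ldu {n} u v w a b = sum-ext (λ c → cong (_* UZ w c b) (mul-diagR (LZ u) (HZ k v) (HFactor.H-off v) a c))

  level-uniq : ∀ {n} (u v w u' v' w' : CZ n) → ValidL u → HFactor.ValidV v → ValidL u' → HFactor.ValidV v' →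
    (∀ a b → Cg m (decZ k u v w a b) (decZ k u' v' w' a b)) →
    (∀ a b → Neg a b → Cg m (u a b) (u' a b)) × (∀ a b → Simple a b → Cg m (v a b) (v' a b)) × (∀ a b → Pos a b → Cg m (w a b) (w' a b))
  level-uniq {n} u v w u' v' w' hu hv hu' hv' h =
      NegSolve.uniq n m u u' (λ a b _ → proj₁ U a b)
    , HFactor.H-uniq v v' hv hv' (proj₁ (proj₂ U))
    , PosSolve.uniq n m w w' (λ a b _ → proj₂ (proj₂ U) a b)
    where
    U = LD.uniq (LZ u) (HFactor.Hd v) (UZ w) (LZ u') (HFactor.Hd v') (UZ w') (L-unitri u) (U-unitri w) (L-unitri u') (U-unitri w') (HFactor.H-unit v hv)
          (λ a b → cg-rewrite (sym (dec-ldu u v w a b)) (sym (dec-ldu u' v' w' a b)) (h a b))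

  record Sol {n} (g : MZ n) : Set where
    field
      u v w : CZ n
      hu : ValidL u
      hv : HFactor.ValidV v
      eq : ∀ a b → Cg m (decZ k u v w a b) (g a b)

  level-exist : ∀ {n} (g : MZ n) → LD.Good g → Cg m (detℤ g) 1ℤ → Sol g
  level-exist {n} g gd hdet = record { u = u ; v = v ; w = w ; hu = hu ; hv = proj₁ (proj₂ torus) ; eq = eq }
    where
    module R = LD.Factorisation (LD.exist g gd)
    u w : CZ n
    u = NegSolve.iter n R.ℓ n
    w = PosSolve.iter n R.μ n
    hu : ValidL u
    hu a b t = cg0→dv (NegSolve.modp n P R.ℓ (λ a b t → dv→cg0 (R.hℓP a b t)) n a b t)
    torus : Σ (CZ n) λ v → HFactor.ValidV v × (∀ c → Cg m (HFactor.Hd v c) (R.d c))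
    torus = HFactor.H-exist R.d R.hd (cg-trans (cg-sym R.hdet) hdet)
    v : CZ n
    v = proj₁ torus
    eq : ∀ a b → Cg m (decZ k u v w a b) (g a b)
    eq a b = cg-trans (cg-≡ (dec-ldu u v w a b))
      (cg-trans (sum-cg (λ c → cg-* (cg-* (LowU-agree (L-unitri u) R.hℓ (NegSolve.exist n m R.ℓ) a c) (proj₂ (proj₂ torus) c))
                                        (UpU-agree (U-unitri w) R.hμ (PosSolve.exist n m R.μ) c b)))
                (R.prod a b))

-- Level k' of the argument
-- works modulo p^(k'+1) with the (k'+1)-st terms of the sequences; the
-- 0-th terms carry no information, as every congruence mod p⁰ holds.
module Assembly (p : ℕ) where

  open import Data.Integer using (_+_; _*_; _-_)
  import Data.Nat.Divisibility as ℕD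

  -- Defs uses the unsigned divisibility of ℤ, the development the signed one
  u⇒s : ∀ {a x} → a ℤD.∣ x → Dv a x
  u⇒s = SD.∣ᵤ⇒∣

  s⇒u : ∀ {a x} → Dv a x → a ℤD.∣ x
  s⇒u = SD.∣⇒∣ᵤ

  pk∣pk+1 : ∀ k → Dv (+ (p ℕ.^ k)) (+ (p ℕ.^ suc k))
  pk∣pk+1 k = divides (+ p) (ℤP.pos-* p (p ℕ.^ k))

  p∣pk+1 : ∀ k → Dv (+ p) (+ (p ℕ.^ suc k))
  p∣pk+1 k = divides (+ (p ℕ.^ k)) (trans (ℤP.pos-* p (p ℕ.^ k)) (ℤP.*-comm (+ p) _))

  residue : ∀ (x : Seq) → IsZp p x → ∀ k → Cg (+ p) (x (suc k)) (x 1)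
  residue x hx zero = cg-refl
  residue x hx (suc k) = cg-trans (cg (dv-trans (p∣pk+1 k) (u⇒s (hx (suc k))))) (residue x hx k)

  residue0 : ∀ (x : Seq) → IsZp p x → InpZp p x → ∀ k → Dv (+ p) (x (suc k))
  residue0 x hx h0 k = cg0→dv (cg-trans (residue x hx k) (dv→cg0 (u⇒s h0)))

  -- only the torus factors depend on the level, through geom, and they are
  -- compatible: decZ (k+1) ≡ decZ k mod pᵏ
  hZ-shift : ∀ {n} k (i j : Fin n) t → Dv (+ p) t → ∀ a b → Cg (+ (p ℕ.^ k)) (hZ (suc k) i j t a b) (hZ k i j t a b)
  hZ-shift k i j t ht a b = cg-if ⌊ a F.≟ b ⌋ (cg-if ⌊ a F.≟ i ⌋ cg-refl (cg-if ⌊ a F.≟ j ⌋ geomShift cg-refl)) cg-refl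
    where
    geomShift : Cg (+ (p ℕ.^ k)) (geom (- t) (suc k)) (geom (- t) k)
    geomShift = cg (dv-≡ (sym (geom-step (- t) k)) (pow-dv p (- t) k (dv-neg ht)))

  dec-shift : ∀ {n} k (u v w : CZ n) → (∀ i j → Simple i j → Dv (+ p) (v i j)) →
    ∀ a b → Cg (+ (p ℕ.^ k)) (decZ (suc k) u v w a b) (decZ k u v w a b)
  dec-shift {n} k u v w hv =
    mulZ-cg {A = mulZ (LZ u) (HZ (suc k) v)} {A' = mulZ (LZ u) (HZ k v)} {B = UZ w} {B' = UZ w}
            (mulZ-cg {A = LZ u} {A' = LZ u} (λ a b → cg-refl) torusShift) (λ a b → cg-refl)
    where
    torusShift : ∀ a b → Cg (+ (p ℕ.^ k)) (HZ (suc k) v a b) (HZ k v a b)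
    torusShift = prodZ-cg (λ r → hZ (suc k) (proj₁ r) (proj₂ r) (v (proj₁ r) (proj₂ r)))
                          (λ r → hZ k (proj₁ r) (proj₂ r) (v (proj₁ r) (proj₂ r))) (simpleRoots n)
                          (All.map (λ {r} e → hZ-shift k (proj₁ r) (proj₂ r) (v (proj₁ r) (proj₂ r)) (hv (proj₁ r) (proj₂ r) e))
                                   (simple-all n))

  limit : ∀ {n} → (ℕ → CZ n) → Coords n
  limit sel a b zero = sel 0 a b
  limit sel a b (suc k) = sel k a b

  limit-IsZp : ∀ {n} (sel : ℕ → CZ n) a b →
    (∀ k → Cg (+ (p ℕ.^ suc k)) (sel (suc k) a b) (sel k a b)) → IsZp p (limit sel a b)
  limit-IsZp sel a b h zero = ℕD.1∣ _
  limit-IsZp sel a b h (suc k) = s⇒u (unCg (h k))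

  ≈-from-levels : ∀ {X Y : Seq} → (∀ k → Cg (+ (p ℕ.^ suc k)) (X (suc k)) (Y (suc k))) → X ≈[ p ] Y
  ≈-from-levels h zero = ℕD.1∣ _
  ≈-from-levels h (suc k) = s⇒u (unCg (h k))

  module Solution {n} (g : Mat n) (hg : InG p g) where

    gK : ℕ → MZ n
    gK k a b = g a b (suc k)

    good : ∀ k → Level.LD.Good p k (gK k)
    good k = (λ a b lt → residue0 (g a b) (proj₁ hg a b) (proj₁ (proj₂ (proj₂ hg)) a b lt) k)
           , (λ a → cg-trans (residue (g a a) (proj₁ hg a a) k) (cg (u⇒s (proj₂ (proj₂ (proj₂ hg)) a))))

    S : ∀ k → Level.Sol p k (gK k)
    S k = Level.level-exist p k (gK k) (good k) (cg (u⇒s (proj₁ (proj₂ hg) (suc k))))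

    U V W : Coords n
    U = limit (λ k → Level.Sol.u (S k))
    V = limit (λ k → Level.Sol.v (S k))
    W = limit (λ k → Level.Sol.w (S k))

    decomposes : decomp U V W ≈M[ p ] g
    decomposes a b zero = ℕD.1∣ _
    decomposes a b (suc k) = s⇒u (dv-≡ (cong (_- g a b (suc k)) (sym (lv-decomp U V W (suc k) a b))) (unCg (Level.Sol.eq (S k) a b)))

    AgreesAt : ℕ → CZ n → CZ n → CZ n → Set
    AgreesAt k u' v' w' =
        (∀ a b → Neg a b → Cg (+ (p ℕ.^ suc k)) (Level.Sol.u (S k) a b) (u' a b))
      × (∀ a b → Simple a b → Cg (+ (p ℕ.^ suc k)) (Level.Sol.v (S k) a b) (v' a b))
      × (∀ a b → Pos a b → Cg (+ (p ℕ.^ suc k)) (Level.Sol.w (S k) a b) (w' a b))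

    agree : ∀ k (u' v' w' : CZ n) → Level.ValidL p k u' → Level.HFactor.ValidV p k v' →
      (∀ a b → Cg (+ (p ℕ.^ suc k)) (decZ (suc k) u' v' w' a b) (gK k a b)) → AgreesAt k u' v' w'
    agree k u' v' w' hu' hv' eq' =
      Level.level-uniq p k s.u s.v s.w u' v' w' s.hu s.hv hu' hv' (λ a b → cg-trans (s.eq a b) (cg-sym (eq' a b)))
      where module s = Level.Sol (S k)

    -- the solution at level k+1 is a solution at level k, hence agrees with S k
    compat : ∀ k → AgreesAt k (Level.Sol.u (S (suc k))) (Level.Sol.v (S (suc k))) (Level.Sol.w (S (suc k)))
    compat k = agree k s.u s.v s.w s.hu s.hv
      (λ a b → cg-trans (cg-sym (dec-shift (suc k) s.u s.v s.w s.hv a b))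
               (cg-trans (cg-weak (pk∣pk+1 (suc k)) (s.eq a b)) (cg (u⇒s (proj₁ hg a b (suc k))))))
      where module s = Level.Sol (S (suc k))

    valid : ValidCoords p U V W
    valid i j =
        (λ t → limit-IsZp (λ k → Level.Sol.u (S k)) i j (λ k → cg-sym (proj₁ (compat k) i j t)) , s⇒u (Level.Sol.hu (S 0) i j t))
      , (λ t → limit-IsZp (λ k → Level.Sol.v (S k)) i j (λ k → cg-sym (proj₁ (proj₂ (compat k)) i j t)) , s⇒u (Level.Sol.hv (S 0) i j t))
      , (λ t → limit-IsZp (λ k → Level.Sol.w (S k)) i j (λ k → cg-sym (proj₂ (proj₂ (compat k)) i j t)))

    unique : (u' v' w' : Coords n) → ValidCoords p u' v' w' → decomp u' v' w' ≈M[ p ] g → SameCoords p U V W u' v' w'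
    unique u' v' w' hv' hd' i j =
        (λ t → ≈-from-levels {U i j} {u' i j} (λ k → proj₁ (agreeₖ k) i j t))
      , (λ t → ≈-from-levels {V i j} {v' i j} (λ k → proj₁ (proj₂ (agreeₖ k)) i j t))
      , (λ t → ≈-from-levels {W i j} {w' i j} (λ k → proj₂ (proj₂ (agreeₖ k)) i j t))
      where
      agreeₖ : ∀ k → AgreesAt k (lvC u' (suc k)) (lvC v' (suc k)) (lvC w' (suc k))
      agreeₖ k = agree k (lvC u' (suc k)) (lvC v' (suc k)) (lvC w' (suc k))
        (λ a b t → residue0 (u' a b) (proj₁ (proj₁ (hv' a b) t)) (proj₂ (proj₁ (hv' a b) t)) k)
        (λ a b t → residue0 (v' a b) (proj₁ (proj₁ (proj₂ (hv' a b)) t)) (proj₂ (proj₁ (proj₂ (hv' a b)) t)) k)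
        (λ a b → cg (dv-≡ (cong (_- g a b (suc k)) (lv-decomp u' v' w' (suc k) a b)) (u⇒s (hd' a b (suc k)))))

open import Data.Nat using (_≤_; _<_; _+_)
open import Data.Nat.Primality using (Prime)

-- the level-wise solutions of Assembly give the coordinates
lemma2p2 : (p : ℕ) → Prime p → (n : ℕ) → 2 ≤ n → n + 1 < p →
    (g : Mat n) → InG p g →
    Σ[ u ∈ Coords n ] Σ[ v ∈ Coords n ] Σ[ w ∈ Coords n ]
    ( ValidCoords p u v w
    × decomp u v w ≈M[ p ] g
    × ((u' v' w' : Coords n) → ValidCoords p u' v' w' →
    decomp u' v' w' ≈M[ p ] g → SameCoords p u v w u' v' w') )
lemma2p2 p _ n _ _ g hg = U , V , W , valid , decomposes , unique
  where open Assembly.Solution p g hg
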